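{- For integers $m,n\ge0$ and $k\ge2$, let $a_{k,n}^{(m)}$ be the number of compositions of $n$ having exactly $m$ parts not congruent to $1$ modulo $k$, each of which is greater than $k$ (with $a_{k,0}^{(0)}=1$ and $a_{k,0}^{(m)}=0$ for $m\ge1$, the empty composition being the unique composition of $0$). Then \[ a_{k,n}^{(m)} = \sum_{ \substack{ \lambda\subseteq (k-2)^m \\ i+(k+1)m+jk+ |\lambda| = n }} \binom{i}{m} \binom{i+j-1}{j} m_\lambda(1^m) = \sum_{i+(k+1)m+jk+\ell(k-1)+h=n} (-1)^\ell \binom{i}{m} \binom{i+j-1}{j} \binom{m}{\ell} \binom{m+h-1}{h}, \] where in the first sum $i,j$ range over nonnegative integers and $\lambda$ over partitions with $\lambda\subseteq(k-2)^m$, and in the second sum $i,j,\ell,h$ range over nonnegative integers.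
   Context: A composition of $n$ is a finite sequence of positive integers summing to $n$; its entries are its parts. Binomial coefficients are defined for all integers $a,b$ by $\binom{a}{b}=\frac{a!}{b!(a-b)!}$ if $a\ge b\ge1$, $\binom{a}{0}=1$, and $\binom{a}{b}=0$ otherwise. For a partition $\lambda$ (a weakly decreasing finite sequence of positive integers), $|\lambda|$ is the sum of its parts, and $\lambda\subseteq r^d$ means $\lambda$ has at most $d$ parts, each at most $r$ (the empty partition included). $m_\lambda(1^d)$ denotes the monomial symmetric function $m_\lambda(x_1,\ldots,x_d)$ evaluated at $x_1=\cdots=x_d=1$; equivalently, if $\lambda\subseteq r^d$ has $m_t$ parts equal to $t$ for $1\le t\le r$ and $m_0=d-(m_1+\cdots+m_r)$, then $m_\lambda(1^d)=\frac{d!}{m_0!m_1!\cdots m_r!}$. -}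

module Defs where

open import Data.Bool using (Bool; true; false; if_then_else_; _∧_; _∨_)
open import Data.Nat using (ℕ; zero; suc; _+_; _*_; _∸_; _≡ᵇ_; _<ᵇ_; NonZero; _!)
open import Data.Nat.Properties using (_!≢0; m*n≢0)
open import Data.Nat.Combinatorics using (_C_)
open import Data.Nat.Divisibility using (_∣?_)
open import Data.Nat.DivMod using (_/_)
open import Data.Integer as ℤ using (ℤ; +_; -[1+_])
open import Data.List using (List; []; _∷_; [_]; map; concatMap; filter; length; upTo; foldr)
open import Data.Nat.ListAction using (sum)
open import Data.Bool.ListAction using (all)
open import Relation.Nullary.Decidable using (⌊_⌋)

sumℕ : ℕ → (ℕ → ℕ) → ℕ
sumℕ n f = sum (map f (upTo (suc n)))

sumℤ : ℕ → (ℕ → ℤ) → ℤ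
sumℤ n f = foldr ℤ._+_ (+ 0) (map f (upTo (suc n)))

sumListℕ : {A : Set} → List A → (A → ℕ) → ℕ
sumListℕ xs f = sum (map f xs)

-- Binomial coefficients for all integers a, b, with the paper's convention:
-- (a choose b) = a!/(b!(a-b)!) if a ≥ b ≥ 1, (a choose 0) = 1, and 0 otherwise.

binom : ℤ → ℤ → ℕ
binom a (+ zero) = 1
binom (+ a) (+ suc b) = a C suc b      -- stdlib: a C b = 0 when b > a
binom -[1+ _ ] (+ suc _) = 0
binom _ -[1+ _ ] = 0

-- compsFuel f n : all compositions of n (lists of positive integers summing
-- to n), built by choosing the first part p ∈ {1,…,n}; the fuel f ≥ n
-- bounds the number of parts.
compsFuel : ℕ → ℕ → List (List ℕ)
compsFuel _ zero = [ [] ]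
compsFuel zero (suc n) = []
compsFuel (suc f) (suc n) =
  concatMap (λ p → map (p ∷_) (compsFuel f (suc n ∸ p))) (map suc (upTo (suc n)))

compositions : ℕ → List (List ℕ)
compositions n = compsFuel n n

-- for a positive integer p: p ≡ 1 (mod k)  ⇔  k ∣ p - 1
cong1 : ℕ → ℕ → Bool
cong1 k p = ⌊ k ∣? (p ∸ 1) ⌋

countB : {A : Set} → (A → Bool) → List A → ℕ
countB P xs = length (filter (λ x → Data.Bool.T? (P x)) xs)
  where import Data.Bool

admissible : ℕ → ℕ → List ℕ → Bool
admissible k m c =
  all (λ p → cong1 k p ∨ (k <ᵇ p)) c ∧ (countB (λ p → if cong1 k p then false else true) c ≡ᵇ m)

a : ℕ → ℕ → ℕ → ℕ
a k n m = countB (admissible k m) (compositions n)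

-- Partitions λ ⊆ r^d : weakly decreasing lists of at most d parts, each in {1,…,r}

boxParts : ℕ → ℕ → List (List ℕ)
boxParts r zero = [ [] ]
boxParts r (suc d) = [] ∷ concatMap (λ p → map (p ∷_) (boxParts p d)) (map suc (upTo r))

mult : ℕ → List ℕ → ℕ
mult t λs = countB (λ x → t ≡ᵇ x) λs

facProd : List ℕ → ℕ
facProd [] = 1
facProd (x ∷ xs) = x ! * facProd xs

facProd≢0 : (xs : List ℕ) → NonZero (facProd xs)
facProd≢0 [] = _
facProd≢0 (x ∷ xs) = m*n≢0 (x !) (facProd xs) {{x !≢0}} {{facProd≢0 xs}}

-- m_λ(1^d) = d! / (m₀! m₁! ⋯ m_r!) for λ ⊆ r^d, m₀ = d - (number of parts of λ)
monomialAtOnes : (r d : ℕ) → List ℕ → ℕ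
monomialAtOnes r d λs = (d ! / facProd ms) {{facProd≢0 ms}}
  where
  ms : List ℕ
  ms = (d ∸ length λs) ∷ map (λ t → mult t λs) (map suc (upTo r))

-- The two sums (all indices range over 0..n, which suffices since k ≥ 2)

sum1 : ℕ → ℕ → ℕ → ℕ
sum1 k n m =
  sumℕ n λ i → sumℕ n λ j → sumListℕ (boxParts (k ∸ 2) m) λ λs →
    if (i + (suc k) * m + j * k + sum λs) ≡ᵇ n
    then binom (+ i) (+ m) * binom (+ (i + j) ℤ.- + 1) (+ j) * monomialAtOnes (k ∸ 2) m λs
    else 0

sum2 : ℕ → ℕ → ℕ → ℤ
sum2 k n m =
  sumℤ n λ i → sumℤ n λ j → sumℤ n λ l → sumℤ n λ h →
    if (i + (suc k) * m + j * k + l * (k ∸ 1) + h) ≡ᵇ n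
    then (ℤ.- (+ 1)) ℤ.^ l ℤ.*
         + (binom (+ i) (+ m) * binom (+ (i + j) ℤ.- + 1) (+ j)
            * binom (+ m) (+ l) * binom (+ (m + h) ℤ.- + 1) (+ h))
    else + 0

module Submission where

open import Defs
open import Data.Nat using (ℕ; _≤_)
open import Data.Integer using (+_)
open import Data.Product using (_×_)
open import Relation.Binary.PropositionalEquality using (_≡_)

open import Algebra.Bundles using (CommutativeSemiring)
open import Data.Bool using (Bool; true; false; if_then_else_; T?; _∧_; _∨_)
open import Data.Bool.ListAction using (all)
open import Data.Bool.Properties using (∧-zeroʳ; ∧-identityʳ)
open import Data.Empty using (⊥-elim)
open import Data.Integer as ℤ using (ℤ) renaming (_+_ to _+ᶻ_)
import Data.Integer.Properties as ZP
open import Algebra.Properties.CommutativeSemigroup ZP.+-commutativeSemigroup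
  using () renaming (interchange to +ᶻ-interchange)
open import Data.Integer.Tactic.RingSolver using (solve-∀)
open import Data.List
  using (List; []; _∷_; [_]; map; upTo; applyUpTo; foldr; _++_; concatMap; concat; replicate; length)
import Data.List.Properties as LP
open import Data.List.Relation.Unary.All using (All; []; _∷_)
import Data.List.Relation.Unary.All as All
import Data.List.Relation.Unary.All.Properties as AllP
open import Data.Nat using (zero; suc; _+_; _*_; _∸_; _<_; z≤n; s≤s; _≡ᵇ_; _<ᵇ_; _!)
open import Data.Nat.Combinatorics
  using (_C_; nCk+nC[k+1]≡[n+1]C[k+1]; k>n⇒nCk≡0; nCk≡n!/k![n-k]!; k![n∸k]!∣n!)
open import Data.Nat.DivMod using (_/_; m/n*n≡m; m*n/n≡m)
open import Data.Nat.Divisibility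
  using (_∣_; _∣?_; ∣⇒≤; n∣n; ∣m+n∣m⇒∣n; ∣m∸n∣n⇒∣m; ∣m∣n⇒∣m+n; divides)
open import Data.Nat.ListAction using (sum)
import Data.Nat.Properties as NP
open import Data.Nat.Induction using (<-rec)
open import Data.Product using (_,_; proj₁; proj₂)
open import Data.Sum using (inj₁; inj₂)
open import Data.Unit using (tt)
open import Level using (0ℓ)
open import Relation.Binary.PropositionalEquality
  using (refl; sym; trans; cong; cong₂; subst; module ≡-Reasoning)
import Relation.Binary.Reasoning.Setoid as SetoidReasoning
open import Relation.Nullary using (¬_; yes; no; Dec)
open import Relation.Nullary.Decidable using (⌊_⌋; dec-true; dec-false)

-- Proof by generating functions.  A power series is its coefficient
-- sequence ℕ → ℤ; with the Cauchy product series form a commutative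
-- semiring (so the ring solver applies), and Y = G + F · Y determines Y
-- when F has no constant term (unique-solution).
--
-- Put E = 1/(1 - x^k), A = x E (one part ≡ 1 mod k), D = 1 + x + ⋯ + x^(k-2)
-- and B = x^(k+1) D A (one part ≢ 1 mod k and > k).  Splitting off the
-- first part, a_m = Σ_n a^(m)_(k,n) x^n satisfies a_0 = 1 + A a_0 and
-- a_(m+1) = B a_m + A a_(m+1).  By Pascal's rule P_m = Σ_i C(i,m) A^i
-- satisfies P_0 = 1 + A P_0 and P_(m+1) = A (P_(m+1) + P_m), so
-- Z_m = x^((k+1)m) P_m D^m obeys the same recursion: a_m = Z_m.  As
-- A^i = x^i Σ_j C(i+j-1,j) x^(jk), both sums are the coefficient of x^n in
-- Z_m, using D^m = Σ_(λ ⊆ (k-2)^m) m_λ(1^m) x^|λ| (binomial theorem on the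
-- largest part) for the first and D^m = (1 - x^(k-1))^m / (1 - x)^m for the
-- second.

-- Integer multiplication is kept opaque: the proofs only ever use its
-- ring laws, and opacity stops the type checker from unfolding products
-- of concrete coefficients while unifying.
infixl 7 _*ᶻ_
opaque
  _*ᶻ_ : ℤ → ℤ → ℤ
  _*ᶻ_ = ℤ._*_

  *ᶻ-def : ∀ x y → x *ᶻ y ≡ x ℤ.* y
  *ᶻ-def x y = refl

  *ᶻ-assoc : ∀ x y z → (x *ᶻ y) *ᶻ z ≡ x *ᶻ (y *ᶻ z)
  *ᶻ-assoc = ZP.*-assoc

  *ᶻ-comm : ∀ x y → x *ᶻ y ≡ y *ᶻ x
  *ᶻ-comm = ZP.*-comm

  *ᶻ-distribˡ-+ : ∀ x y z → x *ᶻ (y +ᶻ z) ≡ x *ᶻ y +ᶻ x *ᶻ z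
  *ᶻ-distribˡ-+ = ZP.*-distribˡ-+

  *ᶻ-distribʳ-+ : ∀ x y z → (y +ᶻ z) *ᶻ x ≡ y *ᶻ x +ᶻ z *ᶻ x
  *ᶻ-distribʳ-+ = ZP.*-distribʳ-+

  *ᶻ-identityˡ : ∀ x → + 1 *ᶻ x ≡ x
  *ᶻ-identityˡ = ZP.*-identityˡ

  *ᶻ-identityʳ : ∀ x → x *ᶻ + 1 ≡ x
  *ᶻ-identityʳ = ZP.*-identityʳ

  *ᶻ-zeroˡ : ∀ x → + 0 *ᶻ x ≡ + 0
  *ᶻ-zeroˡ x = refl

  *ᶻ-zeroʳ : ∀ x → x *ᶻ + 0 ≡ + 0
  *ᶻ-zeroʳ = ZP.*-zeroʳ

  pos-*ᶻ : ∀ m n → + (m * n) ≡ + m *ᶻ + n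
  pos-*ᶻ = ZP.pos-*

-- Σ n f = f 0 + f 1 + ⋯ + f (n - 1)
Σ : ℕ → (ℕ → ℤ) → ℤ
Σ zero f = + 0
Σ (suc n) f = Σ n f +ᶻ f n

cond : Bool → ℤ → ℤ
cond b x = if b then x else + 0

Σ-cong : ∀ n {f g : ℕ → ℤ} → (∀ t → t < n → f t ≡ g t) → Σ n f ≡ Σ n g
Σ-cong zero h = refl
Σ-cong (suc n) h = cong₂ _+ᶻ_ (Σ-cong n (λ t t<n → h t (NP.m≤n⇒m≤1+n t<n))) (h n NP.≤-refl)

Σ-cong′ : ∀ n {f g : ℕ → ℤ} → (∀ t → f t ≡ g t) → Σ n f ≡ Σ n g
Σ-cong′ n h = Σ-cong n (λ t _ → h t)

Σ-0 : ∀ n {f : ℕ → ℤ} → (∀ t → t < n → f t ≡ + 0) → Σ n f ≡ + 0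
Σ-0 zero h = refl
Σ-0 (suc n) h = cong₂ _+ᶻ_ (Σ-0 n (λ t t<n → h t (NP.m≤n⇒m≤1+n t<n))) (h n NP.≤-refl)

Σ-+ : ∀ n (f g : ℕ → ℤ) → Σ n (λ t → f t +ᶻ g t) ≡ Σ n f +ᶻ Σ n g
Σ-+ zero f g = refl
Σ-+ (suc n) f g = trans (cong (_+ᶻ (f n +ᶻ g n)) (Σ-+ n f g))
                        (+ᶻ-interchange (Σ n f) (Σ n g) (f n) (g n))

Σ-*ˡ : ∀ n c (f : ℕ → ℤ) → c *ᶻ Σ n f ≡ Σ n (λ t → c *ᶻ f t)
Σ-*ˡ zero c f = *ᶻ-zeroʳ c
Σ-*ˡ (suc n) c f = trans (*ᶻ-distribˡ-+ c (Σ n f) (f n)) (cong (_+ᶻ c *ᶻ f n) (Σ-*ˡ n c f))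

Σ-*ʳ : ∀ n c (f : ℕ → ℤ) → Σ n f *ᶻ c ≡ Σ n (λ t → f t *ᶻ c)
Σ-*ʳ n c f = trans (*ᶻ-comm (Σ n f) c) (trans (Σ-*ˡ n c f) (Σ-cong′ n (λ t → *ᶻ-comm c (f t))))

Σ-swap : ∀ n m (f : ℕ → ℕ → ℤ) →
  Σ n (λ i → Σ m (λ j → f i j)) ≡ Σ m (λ j → Σ n (λ i → f i j))
Σ-swap zero m f = sym (Σ-0 m (λ _ _ → refl))
Σ-swap (suc n) m f = trans (cong (_+ᶻ Σ m (f n)) (Σ-swap n m f)) (sym (Σ-+ m _ _))

Σ-head : ∀ n (f : ℕ → ℤ) → Σ (suc n) f ≡ f 0 +ᶻ Σ n (λ t → f (suc t))
Σ-head zero f = trans (ZP.+-identityˡ (f 0)) (sym (ZP.+-identityʳ (f 0)))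
Σ-head (suc n) f = trans (cong (_+ᶻ f (suc n)) (Σ-head n f)) (ZP.+-assoc (f 0) _ _)

Σ-ext : ∀ n m {f : ℕ → ℤ} → n ≤ m → (∀ t → n ≤ t → t < m → f t ≡ + 0) → Σ n f ≡ Σ m f
Σ-ext n zero z≤n h = refl
Σ-ext n (suc m) {f} n≤sm h with NP.m≤n⇒m<n∨m≡n n≤sm
... | inj₂ refl = refl
... | inj₁ (s≤s n≤m) = begin
  Σ n f            ≡⟨ Σ-ext n m n≤m (λ t n≤t t<m → h t n≤t (NP.m≤n⇒m≤1+n t<m)) ⟩
  Σ m f            ≡⟨ sym (ZP.+-identityʳ _) ⟩
  Σ m f +ᶻ + 0     ≡⟨ cong (Σ m f +ᶻ_) (sym (h m n≤m NP.≤-refl)) ⟩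
  Σ (suc m) f      ∎
  where open ≡-Reasoning

≡ᵇ-true : ∀ {m n} → m ≡ n → (m ≡ᵇ n) ≡ true
≡ᵇ-true {m} {n} = dec-true (m NP.≟ n)

≡ᵇ-false : ∀ {m n} → ¬ (m ≡ n) → (m ≡ᵇ n) ≡ false
≡ᵇ-false {m} {n} = dec-false (m NP.≟ n)

<ᵇ-true : ∀ {m n} → m < n → (m <ᵇ n) ≡ true
<ᵇ-true {m} {n} = dec-true (m NP.<? n)

<ᵇ-false : ∀ {m n} → ¬ (m < n) → (m <ᵇ n) ≡ false
<ᵇ-false {m} {n} = dec-false (m NP.<? n)

dec-iff : {P Q : Set} (p : Dec P) (q : Dec Q) → (P → Q) → (Q → P) → ⌊ p ⌋ ≡ ⌊ q ⌋
dec-iff (yes _) (yes _) f g = refl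
dec-iff (yes x) (no y) f g = ⊥-elim (y (f x))
dec-iff (no x) (yes y) f g = ⊥-elim (x (g y))
dec-iff (no _) (no _) f g = refl

≡ᵇ-iff : ∀ {m n m′ n′} → (m ≡ n → m′ ≡ n′) → (m′ ≡ n′ → m ≡ n) → (m ≡ᵇ n) ≡ (m′ ≡ᵇ n′)
≡ᵇ-iff {m} {n} f g with m NP.≟ n
... | yes p = trans (≡ᵇ-true p) (sym (≡ᵇ-true (f p)))
... | no ¬p = trans (≡ᵇ-false ¬p) (sym (≡ᵇ-false (λ q → ¬p (g q))))

≡ᵇ-sym : ∀ m n → (m ≡ᵇ n) ≡ (n ≡ᵇ m)
≡ᵇ-sym m n = ≡ᵇ-iff {m} {n} {n} {m} sym sym

cond-cong : ∀ {b b′} x → b ≡ b′ → cond b x ≡ cond b′ x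
cond-cong x refl = refl

cond-0 : ∀ b → cond b (+ 0) ≡ + 0
cond-0 true = refl
cond-0 false = refl

Σ-δ-out : ∀ N c (f : ℕ → ℤ) → N ≤ c → Σ N (λ t → cond (t ≡ᵇ c) (f t)) ≡ + 0
Σ-δ-out N c f N≤c = Σ-0 N (λ t t<N → cond-cong (f t) (≡ᵇ-false (λ e → NP.<-irrefl e (NP.<-≤-trans t<N N≤c))))

Σ-δ : ∀ N c (f : ℕ → ℤ) → c < N → Σ N (λ t → cond (t ≡ᵇ c) (f t)) ≡ f c
Σ-δ (suc N) c f c<sN with NP.m≤n⇒m<n∨m≡n c<sN
... | inj₁ (s≤s c<N) = begin
  Σ N _ +ᶻ cond (N ≡ᵇ c) (f N)
    ≡⟨ cong₂ _+ᶻ_ (Σ-δ N c f c<N) (cond-cong (f N) (≡ᵇ-false (λ e → NP.<-irrefl (sym e) c<N))) ⟩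
  f c +ᶻ + 0 ≡⟨ ZP.+-identityʳ (f c) ⟩
  f c ∎
  where open ≡-Reasoning
... | inj₂ refl = begin
  Σ N _ +ᶻ cond (N ≡ᵇ N) (f N)
    ≡⟨ cong₂ _+ᶻ_ (Σ-δ-out N N f NP.≤-refl) (cond-cong (f N) (≡ᵇ-true {N} refl)) ⟩
  + 0 +ᶻ f N ≡⟨ ZP.+-identityˡ (f N) ⟩
  f N ∎
  where open ≡-Reasoning

ΣL : {A : Set} → List A → (A → ℤ) → ℤ
ΣL [] f = + 0
ΣL (x ∷ xs) f = f x +ᶻ ΣL xs f

ΣL-cong : {A : Set} (xs : List A) {f g : A → ℤ} → (∀ x → f x ≡ g x) → ΣL xs f ≡ ΣL xs g
ΣL-cong [] h = refl
ΣL-cong (x ∷ xs) h = cong₂ _+ᶻ_ (h x) (ΣL-cong xs h)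

ΣL-congAll : {A : Set} (xs : List A) {f g : A → ℤ} → All (λ x → f x ≡ g x) xs → ΣL xs f ≡ ΣL xs g
ΣL-congAll [] [] = refl
ΣL-congAll (x ∷ xs) (p ∷ ps) = cong₂ _+ᶻ_ p (ΣL-congAll xs ps)

ΣL-0 : {A : Set} (xs : List A) (f : A → ℤ) → (∀ x → f x ≡ + 0) → ΣL xs f ≡ + 0
ΣL-0 [] f h = refl
ΣL-0 (x ∷ xs) f h = cong₂ _+ᶻ_ (h x) (ΣL-0 xs f h)

ΣL-+ : {A : Set} (xs : List A) (f g : A → ℤ) → ΣL xs (λ x → f x +ᶻ g x) ≡ ΣL xs f +ᶻ ΣL xs g
ΣL-+ [] f g = refl
ΣL-+ (x ∷ xs) f g = trans (cong (f x +ᶻ g x +ᶻ_) (ΣL-+ xs f g)) (+ᶻ-interchange (f x) (g x) _ _)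

ΣL-*ˡ : {A : Set} (xs : List A) (c : ℤ) (f : A → ℤ) → c *ᶻ ΣL xs f ≡ ΣL xs (λ x → c *ᶻ f x)
ΣL-*ˡ [] c f = *ᶻ-zeroʳ c
ΣL-*ˡ (x ∷ xs) c f = trans (*ᶻ-distribˡ-+ c (f x) _) (cong (c *ᶻ f x +ᶻ_) (ΣL-*ˡ xs c f))

ΣL-++ : {A : Set} (xs ys : List A) (f : A → ℤ) → ΣL (xs ++ ys) f ≡ ΣL xs f +ᶻ ΣL ys f
ΣL-++ [] ys f = sym (ZP.+-identityˡ _)
ΣL-++ (x ∷ xs) ys f = trans (cong (f x +ᶻ_) (ΣL-++ xs ys f)) (sym (ZP.+-assoc (f x) _ _))

ΣL-map : {A B : Set} (xs : List A) (g : A → B) (f : B → ℤ) → ΣL (map g xs) f ≡ ΣL xs (λ x → f (g x))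
ΣL-map [] g f = refl
ΣL-map (x ∷ xs) g f = cong (f (g x) +ᶻ_) (ΣL-map xs g f)

ΣL-concatMap : {A B : Set} (g : A → List B) (xs : List A) (F : B → ℤ) →
  ΣL (concatMap g xs) F ≡ ΣL xs (λ x → ΣL (g x) F)
ΣL-concatMap g [] F = refl
ΣL-concatMap g (x ∷ xs) F = trans (ΣL-++ (g x) (concatMap g xs) F) (cong (ΣL (g x) F +ᶻ_) (ΣL-concatMap g xs F))

ΣL-upTo : ∀ n (f : ℕ → ℤ) → ΣL (upTo n) f ≡ Σ n f
ΣL-upTo n f = go n (λ t → t)
  where
  go : ∀ n (g : ℕ → ℕ) → ΣL (applyUpTo g n) f ≡ Σ n (λ t → f (g t))
  go zero g = refl
  go (suc n) g = trans (cong (f (g 0) +ᶻ_) (go n (λ t → g (suc t)))) (sym (Σ-head n (λ t → f (g t))))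

cast-sumL : {A : Set} (xs : List A) (f : A → ℕ) → + sum (map f xs) ≡ ΣL xs (λ x → + f x)
cast-sumL [] f = refl
cast-sumL (x ∷ xs) f = trans (ZP.pos-+ (f x) (sum (map f xs))) (cong (+ f x +ᶻ_) (cast-sumL xs f))

cast-sumUpTo : ∀ n (f : ℕ → ℕ) → + sum (map f (upTo n)) ≡ Σ n (λ t → + f t)
cast-sumUpTo n f = trans (cast-sumL (upTo n) f) (ΣL-upTo n (λ t → + f t))

foldr-sumUpTo : ∀ n (f : ℕ → ℤ) → foldr _+ᶻ_ (+ 0) (map f (upTo n)) ≡ Σ n f
foldr-sumUpTo n f = trans (go (upTo n)) (ΣL-upTo n f)
  where
  go : (xs : List ℕ) → foldr _+ᶻ_ (+ 0) (map f xs) ≡ ΣL xs f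
  go [] = refl
  go (x ∷ xs) = cong (f x +ᶻ_) (go xs)

cast-if : ∀ b x → + (if b then x else 0) ≡ cond b (+ x)
cast-if true x = refl
cast-if false x = refl

cast-countB : {A : Set} (P : A → Bool) (xs : List A) → + countB P xs ≡ ΣL xs (λ x → cond (P x) (+ 1))
cast-countB P [] = refl
cast-countB P (x ∷ xs) with P x
... | true = trans (ZP.pos-+ 1 (countB P xs)) (cong (+ 1 +ᶻ_) (cast-countB P xs))
... | false = trans (cast-countB P xs) (sym (ZP.+-identityˡ _))

-- Formal power series over ℤ

Ser : Set
Ser = ℕ → ℤ

infix 4 _≈_
record _≈_ (f g : Ser) : Set where
  constructor mk≈
  field at : ∀ n → f n ≡ g n
open _≈_

infixl 6 _⊕_
infixl 7 _⋆_

_⊕_ : Ser → Ser → Ser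
(f ⊕ g) n = f n +ᶻ g n

zeroS : Ser
zeroS n = + 0

X^ : ℕ → Ser
X^ c n = cond (n ≡ᵇ c) (+ 1)

oneS : Ser
oneS = X^ 0

X^-cong : ∀ {a b} → a ≡ b → X^ a ≈ X^ b
X^-cong refl = mk≈ λ n → refl

Σ-rev : ∀ n (F : ℕ → ℤ) → Σ (suc n) F ≡ Σ (suc n) (λ t → F (n ∸ t))
Σ-rev zero F = refl
Σ-rev (suc n) F = begin
  Σ (suc n) F +ᶻ F (suc n)                    ≡⟨ cong (_+ᶻ F (suc n)) (Σ-rev n F) ⟩
  Σ (suc n) (λ t → F (n ∸ t)) +ᶻ F (suc n)    ≡⟨ ZP.+-comm _ (F (suc n)) ⟩
  F (suc n) +ᶻ Σ (suc n) (λ t → F (n ∸ t))    ≡⟨ sym (Σ-head (suc n) (λ t → F (suc n ∸ t))) ⟩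
  Σ (suc (suc n)) (λ t → F (suc n ∸ t))       ∎
  where open ≡-Reasoning

Σ-triangle : ∀ N (F : ℕ → ℕ → ℤ) →
  Σ N (λ t → Σ (suc t) (λ u → F u t)) ≡ Σ N (λ u → Σ (N ∸ u) (λ s → F u (u + s)))
Σ-triangle zero F = refl
Σ-triangle (suc N) F = begin
  Σ N (λ t → Σ (suc t) (λ u → F u t)) +ᶻ Σ (suc N) (λ u → F u N)
    ≡⟨ cong (_+ᶻ Σ (suc N) (λ u → F u N)) (trans (Σ-triangle N F) (sym lastRow)) ⟩
  Σ (suc N) Row +ᶻ Σ (suc N) (λ u → F u N)
    ≡⟨ sym (Σ-+ (suc N) Row _) ⟩
  Σ (suc N) (λ u → Row u +ᶻ F u N)
    ≡⟨ Σ-cong (suc N) (λ u u≤N → extendRow u (NP.≤-pred u≤N)) ⟩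
  Σ (suc N) (λ u → Σ (suc N ∸ u) (λ s → F u (u + s))) ∎
  where
  open ≡-Reasoning
  Row : ℕ → ℤ
  Row u = Σ (N ∸ u) (λ s → F u (u + s))
  lastRow : Σ (suc N) Row ≡ Σ N Row
  lastRow = trans (cong (Σ N Row +ᶻ_) (cong (λ z → Σ z (λ s → F N (N + s))) (NP.n∸n≡0 N)))
                  (ZP.+-identityʳ (Σ N Row))
  extendRow : ∀ u → u ≤ N → Row u +ᶻ F u N ≡ Σ (suc N ∸ u) (λ s → F u (u + s))
  extendRow u u≤N = trans (cong (Row u +ᶻ_) (cong (F u) (sym (NP.m+[n∸m]≡n u≤N))))
                          (cong (λ z → Σ z (λ s → F u (u + s))) (sym (NP.+-∸-assoc 1 u≤N)))

-- The Cauchy product, opaque for the same reason as _*ᶻ_: later proofs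
-- only use the laws proved here.
opaque
  _⋆_ : Ser → Ser → Ser
  (f ⋆ g) n = Σ (suc n) (λ t → f t *ᶻ g (n ∸ t))

  ⋆-def : ∀ f g n → (f ⋆ g) n ≡ Σ (suc n) (λ t → f t *ᶻ g (n ∸ t))
  ⋆-def f g n = refl

  ⋆-cong : ∀ {f f′ g g′} → f ≈ f′ → g ≈ g′ → f ⋆ g ≈ f′ ⋆ g′
  ⋆-cong p q = mk≈ λ n → Σ-cong′ (suc n) (λ t → cong₂ _*ᶻ_ (at p t) (at q (n ∸ t)))

  ⋆-comm : ∀ f g → f ⋆ g ≈ g ⋆ f
  ⋆-comm f g = mk≈ λ n → trans (Σ-rev n _) (Σ-cong (suc n) (λ t t≤n →
    trans (cong (λ z → f (n ∸ t) *ᶻ g z) (NP.m∸[m∸n]≡n (NP.≤-pred t≤n))) (*ᶻ-comm (f (n ∸ t)) _)))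

  ⋆-assoc : ∀ f g h → (f ⋆ g) ⋆ h ≈ f ⋆ (g ⋆ h)
  ⋆-assoc f g h = mk≈ λ n → begin
    Σ (suc n) (λ t → Σ (suc t) (λ u → f u *ᶻ g (t ∸ u)) *ᶻ h (n ∸ t))
      ≡⟨ Σ-cong′ (suc n) (λ t → Σ-*ʳ (suc t) (h (n ∸ t)) _) ⟩
    Σ (suc n) (λ t → Σ (suc t) (λ u → f u *ᶻ g (t ∸ u) *ᶻ h (n ∸ t)))
      ≡⟨ Σ-triangle (suc n) (λ u t → f u *ᶻ g (t ∸ u) *ᶻ h (n ∸ t)) ⟩
    Σ (suc n) (λ u → Σ (suc n ∸ u) (λ s → f u *ᶻ g (u + s ∸ u) *ᶻ h (n ∸ (u + s))))
      ≡⟨ Σ-cong (suc n) (λ u u≤n → inner n u (NP.≤-pred u≤n)) ⟩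
    Σ (suc n) (λ u → f u *ᶻ Σ (suc (n ∸ u)) (λ s → g s *ᶻ h (n ∸ u ∸ s))) ∎
    where
    open ≡-Reasoning
    inner : ∀ n u → u ≤ n →
      Σ (suc n ∸ u) (λ s → f u *ᶻ g (u + s ∸ u) *ᶻ h (n ∸ (u + s)))
        ≡ f u *ᶻ Σ (suc (n ∸ u)) (λ s → g s *ᶻ h (n ∸ u ∸ s))
    inner n u u≤n = begin
      Σ (suc n ∸ u) (λ s → f u *ᶻ g (u + s ∸ u) *ᶻ h (n ∸ (u + s)))
        ≡⟨ cong (λ z → Σ z (λ s → f u *ᶻ g (u + s ∸ u) *ᶻ h (n ∸ (u + s)))) (NP.+-∸-assoc 1 u≤n) ⟩
      Σ (suc (n ∸ u)) (λ s → f u *ᶻ g (u + s ∸ u) *ᶻ h (n ∸ (u + s)))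
        ≡⟨ Σ-cong′ (suc (n ∸ u)) (λ s →
             trans (cong₂ (λ a b → f u *ᶻ g a *ᶻ h b) (NP.m+n∸m≡n u s) (sym (NP.∸-+-assoc n u s)))
                   (*ᶻ-assoc (f u) (g s) (h (n ∸ u ∸ s)))) ⟩
      Σ (suc (n ∸ u)) (λ s → f u *ᶻ (g s *ᶻ h (n ∸ u ∸ s)))
        ≡⟨ sym (Σ-*ˡ (suc (n ∸ u)) (f u) _) ⟩
      f u *ᶻ Σ (suc (n ∸ u)) (λ s → g s *ᶻ h (n ∸ u ∸ s)) ∎

  ⋆-distribˡ : ∀ f g h → f ⋆ (g ⊕ h) ≈ f ⋆ g ⊕ f ⋆ h
  ⋆-distribˡ f g h = mk≈ λ n → trans (Σ-cong′ (suc n) (λ t → *ᶻ-distribˡ-+ (f t) _ _)) (Σ-+ (suc n) _ _)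

  ⋆-distribʳ : ∀ f g h → (g ⊕ h) ⋆ f ≈ g ⋆ f ⊕ h ⋆ f
  ⋆-distribʳ f g h = mk≈ λ n → trans (Σ-cong′ (suc n) (λ t → *ᶻ-distribʳ-+ (f (n ∸ t)) (g t) _)) (Σ-+ (suc n) _ _)

  ⋆-zeroˡ : ∀ f → zeroS ⋆ f ≈ zeroS
  ⋆-zeroˡ f = mk≈ λ n → Σ-0 (suc n) (λ t _ → *ᶻ-zeroˡ (f (n ∸ t)))

  ⋆-zeroʳ : ∀ f → f ⋆ zeroS ≈ zeroS
  ⋆-zeroʳ f = mk≈ λ n → Σ-0 (suc n) (λ t _ → *ᶻ-zeroʳ (f t))

cond-1-* : ∀ b x → cond b (+ 1) *ᶻ x ≡ cond b x
cond-1-* true x = *ᶻ-identityˡ x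
cond-1-* false x = *ᶻ-zeroˡ x

X^⋆-ge : ∀ c f n → c ≤ n → (X^ c ⋆ f) n ≡ f (n ∸ c)
X^⋆-ge c f n c≤n = trans (⋆-def (X^ c) f n)
  (trans (Σ-cong′ (suc n) (λ t → cond-1-* (t ≡ᵇ c) (f (n ∸ t))))
         (Σ-δ (suc n) c (λ t → f (n ∸ t)) (s≤s c≤n)))

X^⋆-lt : ∀ c f n → n < c → (X^ c ⋆ f) n ≡ + 0
X^⋆-lt c f n n<c = trans (⋆-def (X^ c) f n)
  (trans (Σ-cong′ (suc n) (λ t → cond-1-* (t ≡ᵇ c) (f (n ∸ t))))
         (Σ-δ-out (suc n) c (λ t → f (n ∸ t)) n<c))

oneS-⋆ : ∀ f → oneS ⋆ f ≈ f
oneS-⋆ f = mk≈ λ n → X^⋆-ge 0 f n z≤n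

⋆-oneS : ∀ f → f ⋆ oneS ≈ f
⋆-oneS f = mk≈ λ n → trans (at (⋆-comm f oneS) n) (at (oneS-⋆ f) n)

X^-+ : ∀ a b → X^ a ⋆ X^ b ≈ X^ (a + b)
X^-+ a b = mk≈ coeff
  where
  coeff : ∀ n → (X^ a ⋆ X^ b) n ≡ X^ (a + b) n
  coeff n with a NP.≤? n
  ... | no a≰n = trans (X^⋆-lt a (X^ b) n (NP.≰⇒> a≰n))
    (sym (cond-cong (+ 1) (≡ᵇ-false (λ e → a≰n (subst (a ≤_) (sym e) (NP.m≤m+n a b))))))
  ... | yes a≤n = trans (X^⋆-ge a (X^ b) n a≤n) (cond-cong (+ 1)
    (≡ᵇ-iff (λ e → trans (sym (NP.m+[n∸m]≡n a≤n)) (cong (λ z → a + z) e))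
            (λ e → trans (cong (_∸ a) e) (NP.m+n∸m≡n a b))))

-- Series form a commutative semiring, so the ring solver applies to them.
seriesSemiring : CommutativeSemiring 0ℓ 0ℓ
seriesSemiring = record
  { Carrier = Ser ; _≈_ = _≈_ ; _+_ = _⊕_ ; _*_ = _⋆_ ; 0# = zeroS ; 1# = oneS
  ; isCommutativeSemiring = record
    { isSemiring = record
      { isSemiringWithoutAnnihilatingZero = record
        { +-isCommutativeMonoid = record
          { isMonoid = record
            { isSemigroup = record
              { isMagma = record
                { isEquivalence = record
                  { refl = mk≈ λ n → refl
                  ; sym = λ p → mk≈ λ n → sym (at p n)
                  ; trans = λ p q → mk≈ λ n → trans (at p n) (at q n) }
                ; ∙-cong = λ p q → mk≈ λ n → cong₂ _+ᶻ_ (at p n) (at q n) }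
              ; assoc = λ f g h → mk≈ λ n → ZP.+-assoc (f n) (g n) (h n) }
            ; identity = (λ f → mk≈ λ n → ZP.+-identityˡ (f n)) , (λ f → mk≈ λ n → ZP.+-identityʳ (f n)) }
          ; comm = λ f g → mk≈ λ n → ZP.+-comm (f n) (g n) }
        ; *-cong = ⋆-cong
        ; *-assoc = ⋆-assoc
        ; *-identity = oneS-⋆ , ⋆-oneS
        ; distrib = ⋆-distribˡ , ⋆-distribʳ }
      ; zero = ⋆-zeroˡ , ⋆-zeroʳ }
    ; *-comm = ⋆-comm } }

module SR = CommutativeSemiring seriesSemiring
module ≈-Reasoning = SetoidReasoning SR.setoid
open import Algebra.Solver.Ring.NaturalCoefficients.Default seriesSemiring
  using (solve; _:*_; _:+_; _:=_; con)

pow : Ser → ℕ → Ser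
pow f zero = oneS
pow f (suc m) = f ⋆ pow f m

pow-cong : ∀ {f g} i → f ≈ g → pow f i ≈ pow g i
pow-cong zero p = SR.refl
pow-cong (suc i) p = ⋆-cong p (pow-cong i p)

pow-⋆ : ∀ f g i → pow (f ⋆ g) i ≈ pow f i ⋆ pow g i
pow-⋆ f g zero = SR.sym (oneS-⋆ oneS)
pow-⋆ f g (suc i) = SR.trans (⋆-cong SR.refl (pow-⋆ f g i))
  (solve 4 (λ f g a b → (f :* g) :* (a :* b) := (f :* a) :* (g :* b)) SR.refl f g (pow f i) (pow g i))

pow-X^ : ∀ a i → pow (X^ a) i ≈ X^ (i * a)
pow-X^ a zero = SR.refl
pow-X^ a (suc i) = SR.trans (⋆-cong SR.refl (pow-X^ a i)) (X^-+ a (i * a))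

pow-oneS : ∀ j → pow oneS j ≈ oneS
pow-oneS zero = SR.refl
pow-oneS (suc j) = SR.trans (⋆-cong SR.refl (pow-oneS j)) (oneS-⋆ oneS)

-- the coefficient of x^n in f · g only involves coefficients up to n,
-- so a constant-free series F makes  Y = G + F · Y  a recursion for Y
⋆-head-free : ∀ F Y n → F 0 ≡ + 0 → (F ⋆ Y) n ≡ Σ n (λ t → F (suc t) *ᶻ Y (n ∸ suc t))
⋆-head-free F Y n F0 = begin
  (F ⋆ Y) n                                           ≡⟨ ⋆-def F Y n ⟩
  Σ (suc n) (λ t → F t *ᶻ Y (n ∸ t))                  ≡⟨ Σ-head n _ ⟩
  F 0 *ᶻ Y n +ᶻ Rest                                   ≡⟨ cong (λ z → z *ᶻ Y n +ᶻ Rest) F0 ⟩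
  + 0 *ᶻ Y n +ᶻ Rest                                   ≡⟨ cong (_+ᶻ Rest) (*ᶻ-zeroˡ (Y n)) ⟩
  + 0 +ᶻ Rest                                          ≡⟨ ZP.+-identityˡ Rest ⟩
  Rest                                                 ∎
  where
  open ≡-Reasoning
  Rest : ℤ
  Rest = Σ n (λ t → F (suc t) *ᶻ Y (n ∸ suc t))

unique-solution : ∀ (F G Y Y′ : Ser) → F 0 ≡ + 0 →
  Y ≈ G ⊕ F ⋆ Y → Y′ ≈ G ⊕ F ⋆ Y′ → Y ≈ Y′
unique-solution F G Y Y′ F0 hY hY′ = mk≈ (<-rec (λ n → Y n ≡ Y′ n) agree)
  where
  -- by strong induction: the n-th coefficient only involves earlier ones
  agree : ∀ n → (∀ {t} → t < n → Y t ≡ Y′ t) → Y n ≡ Y′ n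
  agree n earlier = begin
    Y n                                              ≡⟨ at hY n ⟩
    G n +ᶻ (F ⋆ Y) n                                 ≡⟨ cong (G n +ᶻ_) (⋆-head-free F Y n F0) ⟩
    G n +ᶻ Σ n (λ t → F (suc t) *ᶻ Y (n ∸ suc t))
      ≡⟨ cong (G n +ᶻ_) (Σ-cong n (λ t t<n → cong (F (suc t) *ᶻ_) (earlier (NP.∸-monoʳ-< (s≤s z≤n) t<n)))) ⟩
    G n +ᶻ Σ n (λ t → F (suc t) *ᶻ Y′ (n ∸ suc t))   ≡⟨ cong (G n +ᶻ_) (sym (⋆-head-free F Y′ n F0)) ⟩
    G n +ᶻ (F ⋆ Y′) n                                ≡⟨ sym (at hY′ n) ⟩
    Y′ n                                             ∎
    where open ≡-Reasoning

choose : ℕ → ℕ → ℕ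
choose i m = binom (+ i) (+ m)

-- C(i + j - 1, j): the number of multisets of size j from i elements
multichoose : ℕ → ℕ → ℕ
multichoose i j = binom (+ (i + j) ℤ.- + 1) (+ j)

choose-C : ∀ i m → choose i m ≡ i C m
choose-C i zero = refl
choose-C i (suc m) = refl

choose-big : ∀ i m → i < m → choose i m ≡ 0
choose-big i (suc m) i<m = k>n⇒nCk≡0 i<m

pascal-choose : ∀ i m → choose (suc i) (suc m) ≡ choose i (suc m) + choose i m
pascal-choose i m = trans (sym (nCk+nC[k+1]≡[n+1]C[k+1] i m))
  (trans (NP.+-comm (i C m) _) (cong (λ z → i C suc m + z) (sym (choose-C i m))))

choose-factorials : ∀ n c → c ≤ n → choose n c * (c ! * (n ∸ c) !) ≡ n !
choose-factorials n c c≤n =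
  trans (cong (_* (c ! * (n ∸ c) !)) (trans (choose-C n c) (nCk≡n!/k![n-k]! c≤n)))
        (m/n*n≡m {{NP.m*n≢0 (c !) ((n ∸ c) !) {{NP._!≢0 c}} {{NP._!≢0 (n ∸ c)}}}} (k![n∸k]!∣n! c≤n))

multichoose-zero : ∀ i → multichoose i 0 ≡ 1
multichoose-zero zero = refl
multichoose-zero (suc i) = refl

multichoose-0 : ∀ j → multichoose 0 (suc j) ≡ 0
multichoose-0 j = k>n⇒nCk≡0 (NP.n<1+n j)

multichoose-C : ∀ i j → multichoose (suc i) j ≡ (i + j) C j
multichoose-C i zero = refl
multichoose-C i (suc j) = refl

pascal-multichoose : ∀ i j →
  multichoose (suc i) (suc j) ≡ multichoose i (suc j) + multichoose (suc i) j
pascal-multichoose zero j = begin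
  multichoose 1 (suc j)          ≡⟨ multichoose-C 0 (suc j) ⟩
  suc j C suc j                  ≡⟨ sym (nCk+nC[k+1]≡[n+1]C[k+1] j j) ⟩
  j C j + j C suc j              ≡⟨ NP.+-comm (j C j) _ ⟩
  j C suc j + j C j              ≡⟨ cong (λ z → j C suc j + z) (sym (multichoose-C 0 j)) ⟩
  multichoose 0 (suc j) + multichoose 1 j ∎
  where open ≡-Reasoning
pascal-multichoose (suc i) j = begin
  multichoose (suc (suc i)) (suc j)         ≡⟨ multichoose-C (suc i) (suc j) ⟩
  (suc i + suc j) C suc j                   ≡⟨ cong (_C suc j) (NP.+-suc (suc i) j) ⟩
  suc (suc i + j) C suc j                   ≡⟨ sym (nCk+nC[k+1]≡[n+1]C[k+1] (suc i + j) j) ⟩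
  (suc i + j) C j + (suc i + j) C suc j     ≡⟨ NP.+-comm ((suc i + j) C j) _ ⟩
  (suc i + j) C suc j + (suc i + j) C j     ≡⟨ cong (λ z → z C suc j + (suc i + j) C j) (sym (NP.+-suc i j)) ⟩
  (i + suc j) C suc j + (suc i + j) C j
    ≡⟨ cong₂ _+_ (sym (multichoose-C i (suc j))) (sym (multichoose-C (suc i) j)) ⟩
  multichoose (suc i) (suc j) + multichoose (suc (suc i)) j ∎
  where open ≡-Reasoning

scal : ℤ → Ser → Ser
scal a f n = a *ᶻ f n

scal-cong : ∀ a {f g} → f ≈ g → scal a f ≈ scal a g
scal-cong a p = mk≈ λ n → cong (a *ᶻ_) (at p n)

scal-⋆ : ∀ a f g → scal a f ⋆ g ≈ scal a (f ⋆ g)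
scal-⋆ a f g = mk≈ λ n → begin
  (scal a f ⋆ g) n                           ≡⟨ ⋆-def (scal a f) g n ⟩
  Σ (suc n) (λ t → a *ᶻ f t *ᶻ g (n ∸ t))    ≡⟨ Σ-cong′ (suc n) (λ t → *ᶻ-assoc a (f t) (g (n ∸ t))) ⟩
  Σ (suc n) (λ t → a *ᶻ (f t *ᶻ g (n ∸ t)))  ≡⟨ sym (Σ-*ˡ (suc n) a _) ⟩
  a *ᶻ Σ (suc n) (λ t → f t *ᶻ g (n ∸ t))    ≡⟨ cong (a *ᶻ_) (sym (⋆-def f g n)) ⟩
  scal a (f ⋆ g) n                           ∎
  where open ≡-Reasoning

⋆-scal : ∀ a f g → f ⋆ scal a g ≈ scal a (f ⋆ g)
⋆-scal a f g = SR.trans (⋆-comm f (scal a g)) (SR.trans (scal-⋆ a g f) (scal-cong a (⋆-comm g f)))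

pow-scal : ∀ a h l → pow (scal a h) l ≈ scal (a ℤ.^ l) (pow h l)
pow-scal a h zero = mk≈ λ n → sym (*ᶻ-identityˡ (oneS n))
pow-scal a h (suc l) = SR.trans (⋆-cong SR.refl (pow-scal a h l))
  (SR.trans (scal-⋆ a h _) (SR.trans (scal-cong a (⋆-scal (a ℤ.^ l) h (pow h l)))
    (mk≈ λ n → trans (sym (*ᶻ-assoc a (a ℤ.^ l) _)) (cong (_*ᶻ pow h (suc l) n) (*ᶻ-def a (a ℤ.^ l))))))

lincomb : ℕ → (ℕ → ℤ) → (ℕ → Ser) → Ser
lincomb N a F n = Σ N (λ c → a c *ᶻ F c n)

⋆-lincomb : ∀ h N a F → h ⋆ lincomb N a F ≈ lincomb N a (λ c → h ⋆ F c)
⋆-lincomb h N a F = mk≈ λ n → begin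
  (h ⋆ lincomb N a F) n                                        ≡⟨ ⋆-def h _ n ⟩
  Σ (suc n) (λ t → h t *ᶻ Σ N (λ c → a c *ᶻ F c (n ∸ t)))      ≡⟨ Σ-cong′ (suc n) (λ t → Σ-*ˡ N (h t) _) ⟩
  Σ (suc n) (λ t → Σ N (λ c → h t *ᶻ (a c *ᶻ F c (n ∸ t))))    ≡⟨ Σ-swap (suc n) N _ ⟩
  Σ N (λ c → Σ (suc n) (λ t → h t *ᶻ (a c *ᶻ F c (n ∸ t))))    ≡⟨ Σ-cong′ N (λ c → pull n c) ⟩
  lincomb N a (λ c → h ⋆ F c) n                                ∎
  where
  open ≡-Reasoning
  pull : ∀ n c → Σ (suc n) (λ t → h t *ᶻ (a c *ᶻ F c (n ∸ t))) ≡ a c *ᶻ (h ⋆ F c) n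
  pull n c = begin
    Σ (suc n) (λ t → h t *ᶻ (a c *ᶻ F c (n ∸ t)))
      ≡⟨ Σ-cong′ (suc n) (λ t → trans (sym (*ᶻ-assoc (h t) (a c) _))
           (trans (cong (_*ᶻ F c (n ∸ t)) (*ᶻ-comm (h t) (a c))) (*ᶻ-assoc (a c) (h t) _))) ⟩
    Σ (suc n) (λ t → a c *ᶻ (h t *ᶻ F c (n ∸ t)))  ≡⟨ sym (Σ-*ˡ (suc n) (a c) _) ⟩
    a c *ᶻ Σ (suc n) (λ t → h t *ᶻ F c (n ∸ t))    ≡⟨ cong (a c *ᶻ_) (sym (⋆-def h (F c) n)) ⟩
    a c *ᶻ (h ⋆ F c) n                             ∎

pascal-Σ : ∀ d (Q : ℕ → ℕ → ℤ) →
  Σ (suc d) (λ c → + choose d c *ᶻ Q c (suc (d ∸ c))) +ᶻ Σ (suc d) (λ c → + choose d c *ᶻ Q (suc c) (d ∸ c))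
    ≡ Σ (suc (suc d)) (λ c → + choose (suc d) c *ᶻ Q c (suc d ∸ c))
pascal-Σ d Q = begin
  Σ (suc d) (λ c → + choose d c *ᶻ Q c (suc (d ∸ c))) +ᶻ Right
    ≡⟨ cong (_+ᶻ Right) shiftLeft ⟩
  (Q 0 (suc d) +ᶻ Left) +ᶻ Right
    ≡⟨ ZP.+-assoc (Q 0 (suc d)) Left Right ⟩
  Q 0 (suc d) +ᶻ (Left +ᶻ Right)
    ≡⟨ cong₂ _+ᶻ_ (sym (*ᶻ-identityˡ (Q 0 (suc d)))) (trans (sym (Σ-+ (suc d) _ _)) (Σ-cong′ (suc d) merge)) ⟩
  + choose (suc d) 0 *ᶻ Q 0 (suc d) +ᶻ Σ (suc d) (λ c → + choose (suc d) (suc c) *ᶻ Q (suc c) (d ∸ c))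
    ≡⟨ sym (Σ-head (suc d) _) ⟩
  Σ (suc (suc d)) (λ c → + choose (suc d) c *ᶻ Q c (suc d ∸ c)) ∎
  where
  open ≡-Reasoning
  Left Right : ℤ
  Left = Σ (suc d) (λ c → + choose d (suc c) *ᶻ Q (suc c) (d ∸ c))
  Right = Σ (suc d) (λ c → + choose d c *ᶻ Q (suc c) (d ∸ c))
  -- the last term of Left carries C(d, d+1) = 0
  shiftLeft : Σ (suc d) (λ c → + choose d c *ᶻ Q c (suc (d ∸ c))) ≡ Q 0 (suc d) +ᶻ Left
  shiftLeft = begin
    Σ (suc d) (λ c → + choose d c *ᶻ Q c (suc (d ∸ c)))
      ≡⟨ Σ-head d _ ⟩
    + 1 *ᶻ Q 0 (suc d) +ᶻ Σ d (λ c → + choose d (suc c) *ᶻ Q (suc c) (suc (d ∸ suc c)))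
      ≡⟨ cong₂ _+ᶻ_ (*ᶻ-identityˡ _) (Σ-cong d (λ c c<d →
           cong (λ z → + choose d (suc c) *ᶻ Q (suc c) z) (sym (NP.+-∸-assoc 1 c<d)))) ⟩
    Q 0 (suc d) +ᶻ Σ d (λ c → + choose d (suc c) *ᶻ Q (suc c) (d ∸ c))
      ≡⟨ cong (Q 0 (suc d) +ᶻ_) (Σ-ext d (suc d) (NP.n≤1+n d) (λ c d≤c c<sd →
           trans (cong (λ z → + z *ᶻ Q (suc c) (d ∸ c)) (choose-big d (suc c) (s≤s d≤c))) (*ᶻ-zeroˡ _))) ⟩
    Q 0 (suc d) +ᶻ Left ∎
  merge : ∀ c → + choose d (suc c) *ᶻ Q (suc c) (d ∸ c) +ᶻ + choose d c *ᶻ Q (suc c) (d ∸ c)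
              ≡ + choose (suc d) (suc c) *ᶻ Q (suc c) (d ∸ c)
  merge c = trans (sym (*ᶻ-distribʳ-+ (Q (suc c) (d ∸ c)) (+ choose d (suc c)) (+ choose d c)))
    (cong (_*ᶻ Q (suc c) (d ∸ c)) (trans (sym (ZP.pos-+ (choose d (suc c)) (choose d c)))
                                         (cong +_ (sym (pascal-choose d c)))))

binomial : ∀ f g d → pow (f ⊕ g) d ≈ lincomb (suc d) (λ c → + choose d c) (λ c → pow g c ⋆ pow f (d ∸ c))
binomial f g zero = mk≈ λ n → sym (trans (ZP.+-identityˡ _) (trans (*ᶻ-identityˡ _) (at (oneS-⋆ oneS) n)))
binomial f g (suc d) = mk≈ λ n → begin
  pow (f ⊕ g) (suc d) n
    ≡⟨ at (⋆-cong SR.refl (binomial f g d)) n ⟩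
  ((f ⊕ g) ⋆ Expansion) n
    ≡⟨ at (⋆-distribʳ Expansion f g) n ⟩
  (f ⋆ Expansion) n +ᶻ (g ⋆ Expansion) n
    ≡⟨ cong₂ _+ᶻ_ (at (⋆-lincomb f (suc d) _ _) n) (at (⋆-lincomb g (suc d) _ _) n) ⟩
  lincomb (suc d) (λ c → + choose d c) (λ c → f ⋆ (pow g c ⋆ pow f (d ∸ c))) n
    +ᶻ lincomb (suc d) (λ c → + choose d c) (λ c → g ⋆ (pow g c ⋆ pow f (d ∸ c))) n
    ≡⟨ cong₂ _+ᶻ_ (Σ-cong′ (suc d) (λ c → cong (+ choose d c *ᶻ_) (at (absorb-f c) n)))
                  (Σ-cong′ (suc d) (λ c → cong (+ choose d c *ᶻ_) (at (SR.sym (⋆-assoc g (pow g c) _)) n))) ⟩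
  Σ (suc d) (λ c → + choose d c *ᶻ Q n c (suc (d ∸ c))) +ᶻ Σ (suc d) (λ c → + choose d c *ᶻ Q n (suc c) (d ∸ c))
    ≡⟨ pascal-Σ d (Q n) ⟩
  lincomb (suc (suc d)) (λ c → + choose (suc d) c) (λ c → pow g c ⋆ pow f (suc d ∸ c)) n ∎
  where
  open ≡-Reasoning
  Expansion : Ser
  Expansion = lincomb (suc d) (λ c → + choose d c) (λ c → pow g c ⋆ pow f (d ∸ c))
  Q : ℕ → ℕ → ℕ → ℤ
  Q n a b = (pow g a ⋆ pow f b) n
  absorb-f : ∀ c → f ⋆ (pow g c ⋆ pow f (d ∸ c)) ≈ pow g c ⋆ pow f (suc (d ∸ c))
  absorb-f c = solve 3 (λ f a b → f :* (a :* b) := a :* (f :* b)) SR.refl f (pow g c) (pow f (d ∸ c))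

cond-* : ∀ b v x → cond b (v *ᶻ x) ≡ v *ᶻ cond b x
cond-* true v x = refl
cond-* false v x = sym (*ᶻ-zeroʳ v)

shift-test : ∀ {a n} g → a ≤ n → (a + g ≡ᵇ n) ≡ (g ≡ᵇ n ∸ a)
shift-test {a} {n} g a≤n =
  ≡ᵇ-iff {a + g} {n} {g} {n ∸ a}
         (λ e → trans (sym (NP.m+n∸m≡n a g)) (cong (_∸ a) e))
         (λ e → trans (cong (λ z → a + z) e) (NP.m+[n∸m]≡n a≤n))

shift-test-false : ∀ {a n} g → ¬ (a ≤ n) → (a + g ≡ᵇ n) ≡ false
shift-test-false {a} g a≰n = ≡ᵇ-false (λ e → a≰n (subst (a ≤_) e (NP.m≤m+n a g)))

X^⋆-coeff : (G : Ser) (a n : ℕ) → Σ (suc n) (λ h → cond (a + h ≡ᵇ n) (G h)) ≡ (X^ a ⋆ G) n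
X^⋆-coeff G a n with a NP.≤? n
... | yes a≤n = begin
  Σ (suc n) (λ h → cond (a + h ≡ᵇ n) (G h))  ≡⟨ Σ-cong′ (suc n) (λ h → cond-cong (G h) (shift-test h a≤n)) ⟩
  Σ (suc n) (λ h → cond (h ≡ᵇ n ∸ a) (G h))  ≡⟨ Σ-δ (suc n) (n ∸ a) G (s≤s (NP.m∸n≤m n a)) ⟩
  G (n ∸ a)                                  ≡⟨ sym (X^⋆-ge a G n a≤n) ⟩
  (X^ a ⋆ G) n                               ∎
  where open ≡-Reasoning
... | no a≰n = trans (Σ-0 (suc n) (λ h _ → cond-cong (G h) (shift-test-false h a≰n)))
                     (sym (X^⋆-lt a G n (NP.≰⇒> a≰n)))

listSer : {A : Set} → List A → (A → ℕ) → (A → ℤ) → Ser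
listSer xs g F s = ΣL xs (λ x → cond (g x ≡ᵇ s) (F x))

listSer-shift : {A : Set} (xs : List A) (g : A → ℕ) (F : A → ℤ) (a n : ℕ) (v : ℤ) →
  ΣL xs (λ x → cond (a + g x ≡ᵇ n) (v *ᶻ F x)) ≡ v *ᶻ (X^ a ⋆ listSer xs g F) n
listSer-shift xs g F a n v with a NP.≤? n
... | yes a≤n = begin
  ΣL xs (λ x → cond (a + g x ≡ᵇ n) (v *ᶻ F x))
    ≡⟨ ΣL-cong xs (λ x → trans (cond-cong (v *ᶻ F x) (shift-test (g x) a≤n)) (cond-* (g x ≡ᵇ n ∸ a) v (F x))) ⟩
  ΣL xs (λ x → v *ᶻ cond (g x ≡ᵇ n ∸ a) (F x))  ≡⟨ sym (ΣL-*ˡ xs v _) ⟩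
  v *ᶻ listSer xs g F (n ∸ a)                    ≡⟨ cong (v *ᶻ_) (sym (X^⋆-ge a _ n a≤n)) ⟩
  v *ᶻ (X^ a ⋆ listSer xs g F) n                 ∎
  where open ≡-Reasoning
... | no a≰n = begin
  ΣL xs (λ x → cond (a + g x ≡ᵇ n) (v *ᶻ F x))   ≡⟨ ΣL-0 xs _ (λ x → cond-cong _ (shift-test-false (g x) a≰n)) ⟩
  + 0                                            ≡⟨ sym (*ᶻ-zeroʳ v) ⟩
  v *ᶻ + 0                                       ≡⟨ cong (v *ᶻ_) (sym (X^⋆-lt a _ n (NP.≰⇒> a≰n))) ⟩
  v *ᶻ (X^ a ⋆ listSer xs g F) n                 ∎
  where open ≡-Reasoning

-- supportSer e F = Σ_j F(j) x^{e(j)}, for exponents with j ≤ e(j); only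
-- the indices j ≤ u can contribute to the coefficient of x^u.
supportSer : (ℕ → ℕ) → (ℕ → ℤ) → Ser
supportSer e F u = Σ (suc u) (λ j → cond (e j ≡ᵇ u) (F j))

supportSer-range : (e : ℕ → ℕ) → (∀ j → j ≤ e j) → (F : ℕ → ℤ) → ∀ u N → u < N →
  Σ N (λ j → cond (e j ≡ᵇ u) (F j)) ≡ supportSer e F u
supportSer-range e j≤e F u N u<N = sym (Σ-ext (suc u) N u<N (λ t u<t t<N →
  cond-cong (F t) (≡ᵇ-false (λ eq → NP.<-irrefl (sym eq) (NP.<-≤-trans u<t (j≤e t))))))

supportSer-⋆ : (e : ℕ → ℕ) → (∀ j → j ≤ e j) → (F : ℕ → ℤ) → ∀ Z n →
  (supportSer e F ⋆ Z) n ≡ Σ (suc n) (λ j → F j *ᶻ (X^ (e j) ⋆ Z) n)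
supportSer-⋆ e j≤e F Z n = begin
  (supportSer e F ⋆ Z) n
    ≡⟨ ⋆-def (supportSer e F) Z n ⟩
  Σ (suc n) (λ t → supportSer e F t *ᶻ Z (n ∸ t))
    ≡⟨ Σ-cong (suc n) (λ t t≤n → trans (cong (_*ᶻ Z (n ∸ t)) (sym (supportSer-range e j≤e F t (suc n) t≤n)))
         (Σ-*ʳ (suc n) (Z (n ∸ t)) (λ j → cond (e j ≡ᵇ t) (F j)))) ⟩
  Σ (suc n) (λ t → Σ (suc n) (λ j → cond (e j ≡ᵇ t) (F j) *ᶻ Z (n ∸ t)))
    ≡⟨ Σ-swap (suc n) (suc n) _ ⟩
  Σ (suc n) (λ j → Σ (suc n) (λ t → cond (e j ≡ᵇ t) (F j) *ᶻ Z (n ∸ t)))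
    ≡⟨ Σ-cong′ (suc n) (λ j → trans (Σ-cong′ (suc n) (λ t → factor j t (e j ≡ᵇ t) (t ≡ᵇ e j) (≡ᵇ-sym (e j) t)))
         (trans (sym (Σ-*ˡ (suc n) (F j) _)) (cong (F j *ᶻ_) (sym (⋆-def (X^ (e j)) Z n))))) ⟩
  Σ (suc n) (λ j → F j *ᶻ (X^ (e j) ⋆ Z) n) ∎
  where
  open ≡-Reasoning
  factor : ∀ j t b b′ → b ≡ b′ → cond b (F j) *ᶻ Z (n ∸ t) ≡ F j *ᶻ (cond b′ (+ 1) *ᶻ Z (n ∸ t))
  factor j t true .true refl = cong (F j *ᶻ_) (sym (*ᶻ-identityˡ _))
  factor j t false .false refl =
    trans (*ᶻ-zeroˡ _) (trans (sym (*ᶻ-zeroʳ (F j))) (cong (F j *ᶻ_) (sym (*ᶻ-zeroˡ _))))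

j≤j*k : ∀ {k} → 1 ≤ k → ∀ j → j ≤ j * k
j≤j*k 1≤k j = subst (_≤ j * _) (NP.*-identityʳ j) (NP.*-monoʳ-≤ j 1≤k)

-- geom k = Σ_j x^{jk} = 1/(1 - x^k)
geom : ℕ → Ser
geom k n = cond ⌊ k ∣? n ⌋ (+ 1)

-- geomPow k i = Σ_j C(i+j-1, j) x^{jk}, which will be 1/(1 - x^k)^i
geomPow : ℕ → ℕ → Ser
geomPow k i = supportSer (λ j → j * k) (λ j → + multichoose i j)

X^-0 : ∀ {k} → 1 ≤ k → X^ k 0 ≡ + 0
X^-0 1≤k = cond-cong (+ 1) (≡ᵇ-false (λ e → NP.<-irrefl e 1≤k))

module _ (k : ℕ) (1≤k : 1 ≤ k) where

  geom-rec : geom k ≈ oneS ⊕ X^ k ⋆ geom k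
  geom-rec = mk≈ coeff
    where
    below-k : ∀ n → n < k → geom k n ≡ oneS n
    below-k zero _ with k ∣? 0
    ... | yes _ = refl
    ... | no ¬d = ⊥-elim (¬d (divides 0 refl))
    below-k (suc n) n<k with k ∣? suc n
    ... | no _ = refl
    ... | yes d = ⊥-elim (NP.<-irrefl refl (NP.<-≤-trans n<k (∣⇒≤ d)))
    coeff : ∀ n → geom k n ≡ (oneS ⊕ X^ k ⋆ geom k) n
    coeff n with k NP.≤? n
    ... | no k≰n = trans (below-k n (NP.≰⇒> k≰n))
      (trans (sym (ZP.+-identityʳ _)) (cong (oneS n +ᶻ_) (sym (X^⋆-lt k (geom k) n (NP.≰⇒> k≰n)))))
    ... | yes k≤n = begin
      cond ⌊ k ∣? n ⌋ (+ 1)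
        ≡⟨ cond-cong (+ 1) (dec-iff (k ∣? n) (k ∣? (n ∸ k))
             (λ d → ∣m+n∣m⇒∣n (subst (k ∣_) (sym (NP.m+[n∸m]≡n k≤n)) d) n∣n)
             (λ d → ∣m∸n∣n⇒∣m k k≤n d n∣n)) ⟩
      geom k (n ∸ k)         ≡⟨ sym (ZP.+-identityˡ _) ⟩
      + 0 +ᶻ geom k (n ∸ k)
        ≡⟨ cong₂ _+ᶻ_ (cond-cong (+ 1) (sym (≡ᵇ-false (λ e → NP.<-irrefl (sym e) (NP.<-≤-trans 1≤k k≤n)))))
                      (sym (X^⋆-ge k (geom k) n k≤n)) ⟩
      oneS n +ᶻ (X^ k ⋆ geom k) n ∎
      where open ≡-Reasoning

  geomPow-0 : geomPow k 0 ≈ oneS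
  geomPow-0 = mk≈ λ n → begin
    Σ (suc n) (λ j → cond (j * k ≡ᵇ n) (+ multichoose 0 j))
      ≡⟨ Σ-head n _ ⟩
    cond (0 ≡ᵇ n) (+ 1) +ᶻ Σ n (λ j → cond (suc j * k ≡ᵇ n) (+ multichoose 0 (suc j)))
      ≡⟨ cong₂ _+ᶻ_ (cond-cong (+ 1) (≡ᵇ-sym 0 n))
           (Σ-0 n (λ j _ → trans (cong (λ z → cond (suc j * k ≡ᵇ n) (+ z)) (multichoose-0 j)) (cond-0 _))) ⟩
    oneS n +ᶻ + 0 ≡⟨ ZP.+-identityʳ _ ⟩
    oneS n ∎
    where open ≡-Reasoning

  shifted-geomPow : ∀ i n →
    Σ n (λ j → cond (k + j * k ≡ᵇ n) (+ multichoose i j)) ≡ (X^ k ⋆ geomPow k i) n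
  shifted-geomPow i n with k NP.≤? n
  ... | yes k≤n = begin
    Σ n (λ j → cond (k + j * k ≡ᵇ n) (+ multichoose i j))
      ≡⟨ Σ-cong′ n (λ j → cond-cong _ (shift-test (j * k) k≤n)) ⟩
    Σ n (λ j → cond (j * k ≡ᵇ n ∸ k) (+ multichoose i j))
      ≡⟨ supportSer-range (λ j → j * k) (j≤j*k 1≤k) (λ j → + multichoose i j) (n ∸ k) n (NP.∸-monoʳ-< 1≤k k≤n) ⟩
    geomPow k i (n ∸ k) ≡⟨ sym (X^⋆-ge k (geomPow k i) n k≤n) ⟩
    (X^ k ⋆ geomPow k i) n ∎
    where open ≡-Reasoning
  ... | no k≰n = trans (Σ-0 n (λ j _ → cond-cong _ (shift-test-false (j * k) k≰n)))
                       (sym (X^⋆-lt k (geomPow k i) n (NP.≰⇒> k≰n)))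

  -- Pascal's rule for multisets, as a recursion of series:
  -- geomPow k (i+1) = geomPow k i + x^k · geomPow k (i+1)
  geomPow-rec : ∀ i → geomPow k (suc i) ≈ geomPow k i ⊕ X^ k ⋆ geomPow k (suc i)
  geomPow-rec i = mk≈ coeff
    where
    coeff : ∀ n → geomPow k (suc i) n ≡ (geomPow k i ⊕ X^ k ⋆ geomPow k (suc i)) n
    coeff n = begin
      Σ (suc n) (λ j → cond (j * k ≡ᵇ n) (+ multichoose (suc i) j))
        ≡⟨ Σ-head n _ ⟩
      cond (0 ≡ᵇ n) (+ multichoose (suc i) 0) +ᶻ Σ n (λ j → test j (+ multichoose (suc i) (suc j)))
        ≡⟨ cong₂ _+ᶻ_ (cong (λ z → cond (0 ≡ᵇ n) (+ z)) (trans (multichoose-zero (suc i)) (sym (multichoose-zero i))))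
             (trans (Σ-cong′ n split) (Σ-+ n _ _)) ⟩
      Head +ᶻ (Old +ᶻ New)      ≡⟨ sym (ZP.+-assoc Head Old New) ⟩
      (Head +ᶻ Old) +ᶻ New      ≡⟨ cong₂ _+ᶻ_ (sym (Σ-head n _)) (shifted-geomPow (suc i) n) ⟩
      geomPow k i n +ᶻ (X^ k ⋆ geomPow k (suc i)) n ∎
      where
      open ≡-Reasoning
      test : ℕ → ℤ → ℤ
      test j = cond (k + j * k ≡ᵇ n)
      Head Old New : ℤ
      Head = cond (0 ≡ᵇ n) (+ multichoose i 0)
      Old = Σ n (λ j → test j (+ multichoose i (suc j)))
      New = Σ n (λ j → test j (+ multichoose (suc i) j))
      split : ∀ j → test j (+ multichoose (suc i) (suc j))
                    ≡ test j (+ multichoose i (suc j)) +ᶻ test j (+ multichoose (suc i) j)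
      split j with k + j * k ≡ᵇ n
      ... | true = trans (cong +_ (pascal-multichoose i j)) (ZP.pos-+ (multichoose i (suc j)) (multichoose (suc i) j))
      ... | false = refl

  pow-geom : ∀ i → pow (geom k) i ≈ geomPow k i
  pow-geom zero = SR.sym geomPow-0
  pow-geom (suc i) =
    unique-solution (X^ k) (geomPow k i) (pow (geom k) (suc i)) (geomPow k (suc i)) (X^-0 1≤k) E-rec (geomPow-rec i)
    where
    -- E^(i+1) = E^i + x^k E^(i+1), from E = 1 + x^k E
    E-rec : pow (geom k) (suc i) ≈ geomPow k i ⊕ X^ k ⋆ pow (geom k) (suc i)
    E-rec = SR.trans (⋆-cong geom-rec SR.refl)
      (SR.trans (solve 3 (λ e x p → (con 1 :+ x :* e) :* p := p :+ x :* (e :* p)) SR.refl (geom k) (X^ k) (pow (geom k) i))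
        (mk≈ λ n → cong (_+ᶻ (X^ k ⋆ pow (geom k) (suc i)) n) (at (pow-geom i) n)))

-- Series in A = x/(1 - x^k), the generating function of one part ≡ 1 (mod k)

module ASeries (k : ℕ) (1≤k : 1 ≤ k) where

  A : Ser
  A = X^ 1 ⋆ geom k

  A-0 : A 0 ≡ + 0
  A-0 = trans (⋆-def (X^ 1) (geom k) 0) (trans (ZP.+-identityˡ _) (*ᶻ-zeroˡ (geom k 0)))

  pow-A : ∀ i → pow A i ≈ X^ i ⋆ geomPow k i
  pow-A i = SR.trans (pow-⋆ (X^ 1) (geom k) i)
    (⋆-cong (SR.trans (pow-X^ 1 i) (X^-cong (NP.*-identityʳ i))) (pow-geom k 1≤k i))

  pow-A-vanish : ∀ i n → n < i → pow A i n ≡ + 0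
  pow-A-vanish (suc i) n (s≤s n≤i) = begin
    pow A (suc i) n                                    ≡⟨ ⋆-head-free A (pow A i) n A-0 ⟩
    Σ n (λ t → A (suc t) *ᶻ pow A i (n ∸ suc t))
      ≡⟨ Σ-0 n (λ t t<n → trans (cong (A (suc t) *ᶻ_)
           (pow-A-vanish i (n ∸ suc t) (NP.<-≤-trans (NP.∸-monoʳ-< (s≤s z≤n) t<n) n≤i))) (*ᶻ-zeroʳ _)) ⟩
    + 0                                                ∎
    where open ≡-Reasoning

  -- Σ_i d_i A^i, a well-defined series since A^i starts at x^i
  ASum : (ℕ → ℤ) → Ser
  ASum d n = Σ (suc n) (λ i → d i *ᶻ pow A i n)

  ASum-range : ∀ d n N → n < N → ASum d n ≡ Σ N (λ i → d i *ᶻ pow A i n)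
  ASum-range d n N n<N = Σ-ext (suc n) N n<N (λ i n<i _ →
    trans (cong (d i *ᶻ_) (pow-A-vanish i n n<i)) (*ᶻ-zeroʳ (d i)))

  ASum-⋆ : ∀ d Z n → (ASum d ⋆ Z) n ≡ Σ (suc n) (λ i → d i *ᶻ (pow A i ⋆ Z) n)
  ASum-⋆ d Z n = begin
    (ASum d ⋆ Z) n ≡⟨ ⋆-def (ASum d) Z n ⟩
    Σ (suc n) (λ t → ASum d t *ᶻ Z (n ∸ t))
      ≡⟨ Σ-cong (suc n) (λ t t≤n → trans (cong (_*ᶻ Z (n ∸ t)) (ASum-range d t (suc n) t≤n))
           (Σ-*ʳ (suc n) (Z (n ∸ t)) _)) ⟩
    Σ (suc n) (λ t → Σ (suc n) (λ i → d i *ᶻ pow A i t *ᶻ Z (n ∸ t)))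
      ≡⟨ Σ-swap (suc n) (suc n) _ ⟩
    Σ (suc n) (λ i → Σ (suc n) (λ t → d i *ᶻ pow A i t *ᶻ Z (n ∸ t)))
      ≡⟨ Σ-cong′ (suc n) (λ i → trans (Σ-cong′ (suc n) (λ t → *ᶻ-assoc (d i) (pow A i t) (Z (n ∸ t))))
           (trans (sym (Σ-*ˡ (suc n) (d i) _)) (cong (d i *ᶻ_) (sym (⋆-def (pow A i) Z n))))) ⟩
    Σ (suc n) (λ i → d i *ᶻ (pow A i ⋆ Z) n) ∎
    where open ≡-Reasoning

  ASum-rec : ∀ d → ASum d ≈ scal (d 0) oneS ⊕ A ⋆ ASum (λ i → d (suc i))
  ASum-rec d = mk≈ λ n → trans (Σ-head n _) (cong (d 0 *ᶻ oneS n +ᶻ_) (tail n))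
    where
    open ≡-Reasoning
    tail : ∀ n → Σ n (λ i → d (suc i) *ᶻ pow A (suc i) n) ≡ (A ⋆ ASum (λ i → d (suc i))) n
    tail n = begin
      Σ n (λ i → d (suc i) *ᶻ pow A (suc i) n)
        ≡⟨ Σ-ext n (suc n) (NP.n≤1+n n) (λ i n≤i i<sn → trans (cong (d (suc i) *ᶻ_)
             (pow-A-vanish (suc i) n (s≤s n≤i))) (*ᶻ-zeroʳ _)) ⟩
      Σ (suc n) (λ i → d (suc i) *ᶻ pow A (suc i) n)
        ≡⟨ Σ-cong′ (suc n) (λ i → cong (d (suc i) *ᶻ_) (at (⋆-comm A (pow A i)) n)) ⟩
      Σ (suc n) (λ i → d (suc i) *ᶻ (pow A i ⋆ A) n)   ≡⟨ sym (ASum-⋆ (λ i → d (suc i)) A n) ⟩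
      (ASum (λ i → d (suc i)) ⋆ A) n                   ≡⟨ at (⋆-comm _ A) n ⟩
      (A ⋆ ASum (λ i → d (suc i))) n                   ∎

  ASum-+ : ∀ d d′ → ASum (λ i → d i +ᶻ d′ i) ≈ ASum d ⊕ ASum d′
  ASum-+ d d′ = mk≈ λ n → trans (Σ-cong′ (suc n) (λ i → *ᶻ-distribʳ-+ (pow A i n) (d i) (d′ i))) (Σ-+ (suc n) _ _)

  -- P m = Σ_i C(i, m) A^i  (= A^m / (1 - A)^{m+1})
  P : ℕ → Ser
  P m = ASum (λ i → + choose i m)

  P-rec-0 : P 0 ≈ oneS ⊕ A ⋆ P 0
  P-rec-0 = mk≈ λ n → trans (at (ASum-rec _) n) (cong (_+ᶻ (A ⋆ P 0) n) (*ᶻ-identityˡ (oneS n)))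

  -- Pascal's rule gives  P (m+1) = A · (P (m+1) + P m)
  P-rec-suc : ∀ m → P (suc m) ≈ A ⋆ (P (suc m) ⊕ P m)
  P-rec-suc m = mk≈ λ n → begin
    P (suc m) n
      ≡⟨ at (ASum-rec _) n ⟩
    + 0 *ᶻ oneS n +ᶻ (A ⋆ Shifted) n
      ≡⟨ trans (cong (_+ᶻ (A ⋆ Shifted) n) (*ᶻ-zeroˡ (oneS n))) (ZP.+-identityˡ _) ⟩
    (A ⋆ Shifted) n
      ≡⟨ at (⋆-cong SR.refl (SR.trans (mk≈ λ t → Σ-cong′ (suc t) (λ i → cong (_*ᶻ pow A i t) (pascal i))) (ASum-+ _ _))) n ⟩
    (A ⋆ (P (suc m) ⊕ P m)) n ∎
    where
    open ≡-Reasoning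
    Shifted : Ser
    Shifted = ASum (λ i → + choose (suc i) (suc m))
    pascal : ∀ i → + choose (suc i) (suc m) ≡ + choose i (suc m) +ᶻ + choose i m
    pascal i = trans (cong +_ (pascal-choose i m)) (ZP.pos-+ (choose i (suc m)) (choose i m))

  ij-sum : ∀ m c Y n →
    Σ (suc n) (λ i → Σ (suc n) (λ j → (+ choose i m *ᶻ + multichoose i j) *ᶻ (X^ (i + c + j * k) ⋆ Y) n))
      ≡ (X^ c ⋆ (P m ⋆ Y)) n
  ij-sum m c Y n = begin
    Σ (suc n) (λ i → Σ (suc n) (λ j → (+ choose i m *ᶻ + multichoose i j) *ᶻ (X^ (i + c + j * k) ⋆ Y) n))
      ≡⟨ Σ-cong′ (suc n) (λ i → trans (Σ-cong′ (suc n) (λ j → trans (*ᶻ-assoc (+ choose i m) (+ multichoose i j) _)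
            (cong (λ z → + choose i m *ᶻ (+ multichoose i j *ᶻ z)) (at (split-exponent i j) n))))
          (sym (Σ-*ˡ (suc n) (+ choose i m) _))) ⟩
    Σ (suc n) (λ i → + choose i m *ᶻ Σ (suc n) (λ j → + multichoose i j *ᶻ (X^ (j * k) ⋆ (X^ (i + c) ⋆ Y)) n))
      ≡⟨ Σ-cong′ (suc n) (λ i → cong (+ choose i m *ᶻ_)
           (sym (supportSer-⋆ (λ j → j * k) (j≤j*k 1≤k) (λ j → + multichoose i j) (X^ (i + c) ⋆ Y) n))) ⟩
    Σ (suc n) (λ i → + choose i m *ᶻ (geomPow k i ⋆ (X^ (i + c) ⋆ Y)) n)
      ≡⟨ Σ-cong′ (suc n) (λ i → cong (+ choose i m *ᶻ_) (at (collect i) n)) ⟩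
    Σ (suc n) (λ i → + choose i m *ᶻ (pow A i ⋆ (X^ c ⋆ Y)) n)
      ≡⟨ sym (ASum-⋆ (λ i → + choose i m) (X^ c ⋆ Y) n) ⟩
    (P m ⋆ (X^ c ⋆ Y)) n
      ≡⟨ at (solve 3 (λ p x y → p :* (x :* y) := x :* (p :* y)) SR.refl (P m) (X^ c) Y) n ⟩
    (X^ c ⋆ (P m ⋆ Y)) n ∎
    where
    open ≡-Reasoning
    split-exponent : ∀ i j → X^ (i + c + j * k) ⋆ Y ≈ X^ (j * k) ⋆ (X^ (i + c) ⋆ Y)
    split-exponent i j = SR.trans (⋆-cong (SR.trans (X^-cong (NP.+-comm (i + c) (j * k))) (SR.sym (X^-+ (j * k) (i + c)))) SR.refl)
                                  (⋆-assoc (X^ (j * k)) (X^ (i + c)) Y)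
    collect : ∀ i → geomPow k i ⋆ (X^ (i + c) ⋆ Y) ≈ pow A i ⋆ (X^ c ⋆ Y)
    collect i = SR.trans (⋆-cong SR.refl (⋆-cong (SR.sym (X^-+ i c)) SR.refl))
      (SR.trans (solve 4 (λ h a b y → h :* ((a :* b) :* y) := (a :* h) :* (b :* y)) SR.refl (geomPow k i) (X^ i) (X^ c) Y)
        (⋆-cong (SR.sym (pow-A i)) SR.refl))

D : ℕ → Ser
D zero = oneS
D (suc r) = D r ⊕ X^ (suc r)

D-above : ∀ r n → r < n → D r n ≡ + 0
D-above zero (suc n) _ = refl
D-above (suc r) n (s≤s r<n) = trans (cong (_+ᶻ X^ (suc r) n) (D-above r n (NP.m<n⇒m<1+n r<n)))
  (cong (+ 0 +ᶻ_) (cond-cong (+ 1) (≡ᵇ-false (λ e → NP.<-irrefl (sym e) r<n))))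

D-below : ∀ r n → n ≤ r → D r n ≡ + 1
D-below zero zero _ = refl
D-below (suc r) n n≤sr with NP.m≤n⇒m<n∨m≡n n≤sr
... | inj₁ (s≤s n≤r) = trans (cong (_+ᶻ X^ (suc r) n) (D-below r n n≤r))
  (cong (+ 1 +ᶻ_) (cond-cong (+ 1) (≡ᵇ-false (λ e → NP.<-irrefl e (s≤s n≤r)))))
... | inj₂ refl = trans (cong (_+ᶻ X^ (suc r) (suc r)) (D-above r (suc r) NP.≤-refl))
  (cong (+ 0 +ᶻ_) (cond-cong (+ 1) (≡ᵇ-true {suc r} refl)))

geom1-split : ∀ r → geom 1 ≈ D r ⊕ X^ (suc r) ⋆ geom 1
geom1-split zero = geom-rec 1 NP.≤-refl
geom1-split (suc r) = SR.trans (geom1-split r)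
  (SR.trans (SR.+-cong (SR.refl {D r}) (SR.trans (⋆-cong SR.refl (geom-rec 1 NP.≤-refl))
     (SR.trans (solve 3 (λ x y o → x :* (con 1 :+ y :* o) := x :+ (x :* y) :* o) SR.refl (X^ (suc r)) (X^ 1) (geom 1))
       (SR.+-cong (SR.refl {X^ (suc r)}) (⋆-cong (SR.trans (X^-+ (suc r) 1) (X^-cong (NP.+-comm (suc r) 1))) SR.refl)))))
    (SR.sym (SR.+-assoc (D r) (X^ (suc r)) (X^ (suc (suc r)) ⋆ geom 1))))

D-quotient : ∀ r → D r ≈ (oneS ⊕ scal (ℤ.- + 1) (X^ (suc r))) ⋆ geom 1
D-quotient r = SR.sym (begin
  (oneS ⊕ scal (ℤ.- + 1) (X^ (suc r))) ⋆ geom 1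
    ≈⟨ ⋆-distribʳ (geom 1) oneS _ ⟩
  oneS ⋆ geom 1 ⊕ scal (ℤ.- + 1) (X^ (suc r)) ⋆ geom 1
    ≈⟨ SR.+-cong (oneS-⋆ (geom 1)) (scal-⋆ (ℤ.- + 1) (X^ (suc r)) (geom 1)) ⟩
  geom 1 ⊕ scal (ℤ.- + 1) (X^ (suc r) ⋆ geom 1)
    ≈⟨ SR.+-cong (geom1-split r) SR.refl ⟩
  D r ⊕ X^ (suc r) ⋆ geom 1 ⊕ scal (ℤ.- + 1) (X^ (suc r) ⋆ geom 1)
    ≈⟨ mk≈ (λ n → cancel (D r n) ((X^ (suc r) ⋆ geom 1) n)) ⟩
  D r ∎)
  where
  open ≈-Reasoning
  cancel : ∀ a b → a +ᶻ b +ᶻ ℤ.- + 1 *ᶻ b ≡ a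
  cancel a b = trans (ZP.+-assoc a b _) (trans (cong (λ z → a +ᶻ (b +ᶻ z)) (trans (*ᶻ-def _ b) (ZP.-1*i≡-i b)))
    (trans (cong (a +ᶻ_) (ZP.+-inverseʳ b)) (ZP.+-identityʳ a)))

sgn : ℕ → ℤ
sgn l = (ℤ.- + 1) ℤ.^ l

multichooseSer : ℕ → Ser
multichooseSer m h = + multichoose m h

multichooseSer-pow : ∀ m → multichooseSer m ≈ pow (geom 1) m
multichooseSer-pow m = SR.sym (SR.trans (pow-geom 1 NP.≤-refl m) (mk≈ λ h →
  trans (Σ-cong′ (suc h) (λ j → cond-cong (+ multichoose m j) (cong (_≡ᵇ h) (NP.*-identityʳ j))))
        (Σ-δ (suc h) h (λ j → + multichoose m j) NP.≤-refl)))

signedSer : ℕ → ℕ → Ser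
signedSer s m = supportSer (λ l → l * s) (λ l → sgn l *ᶻ + choose m l)

-- the binomial theorem for (1 + (-x^s))^m
signedSer-pow : ∀ {s} → 1 ≤ s → ∀ m → signedSer s m ≈ pow (oneS ⊕ scal (ℤ.- + 1) (X^ s)) m
signedSer-pow {s} 1≤s m = SR.sym (SR.trans (binomial oneS (scal (ℤ.- + 1) (X^ s)) m) (mk≈ λ v → begin
  Σ (suc m) (λ l → + choose m l *ᶻ (pow (scal (ℤ.- + 1) (X^ s)) l ⋆ pow oneS (m ∸ l)) v)
    ≡⟨ Σ-cong′ (suc m) (λ l → cong (+ choose m l *ᶻ_) (at (signed-power l) v)) ⟩
  Σ (suc m) (λ l → + choose m l *ᶻ (sgn l *ᶻ X^ (l * s) v))
    ≡⟨ Σ-cong′ (suc m) (λ l → as-cond v l (l * s ≡ᵇ v) (v ≡ᵇ l * s) (≡ᵇ-sym (l * s) v)) ⟩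
  Σ (suc m) (Term v)
    ≡⟨ Σ-ext (suc m) (suc v + suc m) (NP.m≤n+m (suc m) (suc v)) (λ l m<l _ →
         trans (cong (λ z → cond (l * s ≡ᵇ v) (sgn l *ᶻ + z)) (choose-big m l m<l))
               (trans (cong (cond (l * s ≡ᵇ v)) (*ᶻ-zeroʳ (sgn l))) (cond-0 _))) ⟩
  Σ (suc v + suc m) (Term v)
    ≡⟨ supportSer-range (λ l → l * s) (j≤j*k 1≤s) _ v (suc v + suc m) (NP.m≤m+n (suc v) (suc m)) ⟩
  signedSer s m v ∎))
  where
  open ≡-Reasoning
  Term : ℕ → ℕ → ℤ
  Term v l = cond (l * s ≡ᵇ v) (sgn l *ᶻ + choose m l)
  signed-power : ∀ l → pow (scal (ℤ.- + 1) (X^ s)) l ⋆ pow oneS (m ∸ l) ≈ scal (sgn l) (X^ (l * s))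
  signed-power l = SR.trans (⋆-cong SR.refl (pow-oneS (m ∸ l)))
    (SR.trans (⋆-oneS _) (SR.trans (pow-scal (ℤ.- + 1) (X^ s) l) (scal-cong (sgn l) (pow-X^ s l))))
  as-cond : ∀ v l b b′ → b ≡ b′ → + choose m l *ᶻ (sgn l *ᶻ cond b′ (+ 1)) ≡ cond b (sgn l *ᶻ + choose m l)
  as-cond v l true .true refl = trans (cong (+ choose m l *ᶻ_) (*ᶻ-identityʳ (sgn l))) (*ᶻ-comm _ _)
  as-cond v l false .false refl = trans (cong (+ choose m l *ᶻ_) (*ᶻ-zeroʳ (sgn l))) (*ᶻ-zeroʳ _)

signed-multichoose-pow : ∀ r m → signedSer (suc r) m ⋆ multichooseSer m ≈ pow (D r) m
signed-multichoose-pow r m =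
  SR.trans (⋆-cong (signedSer-pow (s≤s z≤n) m) (multichooseSer-pow m))
    (SR.trans (SR.sym (pow-⋆ _ (geom 1) m)) (pow-cong m (SR.sym (D-quotient r))))

-- Partitions in a box: decomposition by the number of largest parts

boxParts-split : ∀ r d → boxParts (suc r) (suc d) ≡ boxParts r (suc d) ++ map (suc r ∷_) (boxParts (suc r) d)
boxParts-split r d = cong ([] ∷_) (begin
  concatMap g (map suc (upTo (suc r)))                   ≡⟨ cong (λ z → concatMap g (map suc z)) (sym (LP.upTo-∷ʳ r)) ⟩
  concatMap g (map suc (upTo r ++ [ r ]))                ≡⟨ cong (concatMap g) (LP.map-++ suc (upTo r) [ r ]) ⟩
  concatMap g (map suc (upTo r) ++ [ suc r ])            ≡⟨ LP.concatMap-++ g (map suc (upTo r)) [ suc r ] ⟩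
  concatMap g (map suc (upTo r)) ++ (g (suc r) ++ [])    ≡⟨ cong (concatMap g (map suc (upTo r)) ++_) (LP.++-identityʳ (g (suc r))) ⟩
  concatMap g (map suc (upTo r)) ++ g (suc r)            ∎)
  where
  open ≡-Reasoning
  g : ℕ → List (List ℕ)
  g p = map (p ∷_) (boxParts p d)

ΣL-boxParts : ∀ r d (F : List ℕ → ℤ) →
  ΣL (boxParts (suc r) d) F ≡ Σ (suc d) (λ c → ΣL (boxParts r (d ∸ c)) (λ μ → F (replicate c (suc r) ++ μ)))
ΣL-boxParts r zero F = sym (ZP.+-identityˡ _)
ΣL-boxParts r (suc d) F = begin
  ΣL (boxParts (suc r) (suc d)) F
    ≡⟨ cong (λ z → ΣL z F) (boxParts-split r d) ⟩
  ΣL (boxParts r (suc d) ++ map (suc r ∷_) (boxParts (suc r) d)) F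
    ≡⟨ ΣL-++ (boxParts r (suc d)) _ F ⟩
  ΣL (boxParts r (suc d)) F +ᶻ ΣL (map (suc r ∷_) (boxParts (suc r) d)) F
    ≡⟨ cong (ΣL (boxParts r (suc d)) F +ᶻ_) (trans (ΣL-map (boxParts (suc r) d) (suc r ∷_) F)
                                                  (ΣL-boxParts r d (λ x → F (suc r ∷ x)))) ⟩
  ΣL (boxParts r (suc d)) F +ᶻ Σ (suc d) (λ c → ΣL (boxParts r (d ∸ c)) (λ μ → F (suc r ∷ (replicate c (suc r) ++ μ))))
    ≡⟨ sym (Σ-head (suc d) _) ⟩
  Σ (suc (suc d)) (λ c → ΣL (boxParts r (suc d ∸ c)) (λ μ → F (replicate c (suc r) ++ μ))) ∎
  where open ≡-Reasoning

All-boxParts : ∀ r d (P : List ℕ → Set) →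
  (∀ c → c ≤ d → All (λ μ → P (replicate c (suc r) ++ μ)) (boxParts r (d ∸ c))) → All P (boxParts (suc r) d)
All-boxParts r zero P h with h 0 z≤n
... | p ∷ [] = p ∷ []
All-boxParts r (suc d) P h = subst (All P) (sym (boxParts-split r d))
  (AllP.++⁺ (h 0 z≤n) (AllP.map⁺ (All-boxParts r d (λ x → P (suc r ∷ x)) (λ c c≤d → h (suc c) (s≤s c≤d)))))

sum-replicate : ∀ c p μ → sum (replicate c p ++ μ) ≡ c * p + sum μ
sum-replicate zero p μ = refl
sum-replicate (suc c) p μ = trans (cong (λ z → p + z) (sum-replicate c p μ)) (sym (NP.+-assoc p (c * p) (sum μ)))

mult-hit : ∀ {t x} xs → t ≡ x → mult t (x ∷ xs) ≡ suc (mult t xs)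
mult-hit {t} {x} xs e = cong length (LP.filter-accept (λ y → T? (t ≡ᵇ y)) (NP.≡⇒≡ᵇ t x e))

mult-miss : ∀ {t x} xs → ¬ (t ≡ x) → mult t (x ∷ xs) ≡ mult t xs
mult-miss {t} {x} xs ne = cong length (LP.filter-reject (λ y → T? (t ≡ᵇ y)) (λ p → ne (NP.≡ᵇ⇒≡ t x p)))

mult-replicate-miss : ∀ {t p} c μ → ¬ (t ≡ p) → mult t (replicate c p ++ μ) ≡ mult t μ
mult-replicate-miss zero μ ne = refl
mult-replicate-miss (suc c) μ ne = trans (mult-miss _ ne) (mult-replicate-miss c μ ne)

mult-replicate-hit : ∀ p c μ → mult p (replicate c p ++ μ) ≡ c + mult p μ
mult-replicate-hit p zero μ = refl
mult-replicate-hit p (suc c) μ = trans (mult-hit {p} {p} _ refl) (cong suc (mult-replicate-hit p c μ))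

mult-above : ∀ r μ → All (_≤ r) μ → mult (suc r) μ ≡ 0
mult-above r [] [] = refl
mult-above r (x ∷ μ) (x≤r ∷ h) = trans (mult-miss μ (λ e → NP.<-irrefl (sym e) (s≤s x≤r))) (mult-above r μ h)

facProd-++ : ∀ xs ys → facProd (xs ++ ys) ≡ facProd xs * facProd ys
facProd-++ [] ys = sym (NP.+-identityʳ _)
facProd-++ (x ∷ xs) ys = trans (cong (x ! *_) (facProd-++ xs ys)) (sym (NP.*-assoc (x !) _ _))

applyUpTo-cong : {A : Set} (N : ℕ) (g h : ℕ → A) → (∀ u → u < N → g u ≡ h u) → applyUpTo g N ≡ applyUpTo h N
applyUpTo-cong zero g h p = refl
applyUpTo-cong (suc N) g h p =
  cong₂ _∷_ (p 0 (s≤s z≤n)) (applyUpTo-cong N (λ u → g (suc u)) (λ u → h (suc u)) (λ u u<N → p (suc u) (s≤s u<N)))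

partFactorials : ℕ → List ℕ → ℕ
partFactorials r μ = facProd (map (λ t → mult t μ) (map suc (upTo r)))

multiplicities : ℕ → ℕ → List ℕ → List ℕ
multiplicities r d μ = (d ∸ length μ) ∷ map (λ t → mult t μ) (map suc (upTo r))

multFactorials : ℕ → ℕ → List ℕ → ℕ
multFactorials r d μ = facProd (multiplicities r d μ)

monomialAtOnes-val : ∀ r d μ v → v * multFactorials r d μ ≡ d ! → monomialAtOnes r d μ ≡ v
monomialAtOnes-val r d μ v eq = trans (cong (λ z → (z / multFactorials r d μ) {{facProd≢0 (multiplicities r d μ)}}) (sym eq))
  (m*n/n≡m v (multFactorials r d μ) {{facProd≢0 (multiplicities r d μ)}})

partFactorials-suc : ∀ r λs → partFactorials (suc r) λs ≡ partFactorials r λs * (mult (suc r) λs ! * 1)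
partFactorials-suc r λs = begin
  facProd (map m (map suc (upTo (suc r))))         ≡⟨ cong (λ z → facProd (map m (map suc z))) (sym (LP.upTo-∷ʳ r)) ⟩
  facProd (map m (map suc (upTo r ++ [ r ])))      ≡⟨ cong (λ z → facProd (map m z)) (LP.map-++ suc (upTo r) [ r ]) ⟩
  facProd (map m (map suc (upTo r) ++ [ suc r ]))  ≡⟨ cong facProd (LP.map-++ m (map suc (upTo r)) [ suc r ]) ⟩
  facProd (map m (map suc (upTo r)) ++ [ m (suc r) ]) ≡⟨ facProd-++ (map m (map suc (upTo r))) [ m (suc r) ] ⟩
  partFactorials r λs * (mult (suc r) λs ! * 1)    ∎
  where
  open ≡-Reasoning
  m : ℕ → ℕ
  m t = mult t λs

partFactorials-prepend : ∀ r c μ → partFactorials r (replicate c (suc r) ++ μ) ≡ partFactorials r μ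
partFactorials-prepend r c μ = cong facProd (begin
  map (λ t → mult t λs) (map suc (upTo r))   ≡⟨ sym (LP.map-∘ (upTo r)) ⟩
  map (λ u → mult (suc u) λs) (upTo r)       ≡⟨ LP.map-upTo (λ u → mult (suc u) λs) r ⟩
  applyUpTo (λ u → mult (suc u) λs) r
    ≡⟨ applyUpTo-cong r _ _ (λ u u<r → mult-replicate-miss c μ (λ e → NP.<-irrefl (NP.suc-injective e) u<r)) ⟩
  applyUpTo (λ u → mult (suc u) μ) r         ≡⟨ sym (LP.map-upTo (λ u → mult (suc u) μ) r) ⟩
  map (λ u → mult (suc u) μ) (upTo r)        ≡⟨ LP.map-∘ (upTo r) ⟩
  map (λ t → mult t μ) (map suc (upTo r))    ∎)
  where
  open ≡-Reasoning
  λs = replicate c (suc r) ++ μ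

multFactorials-prepend : ∀ r d c μ → All (_≤ r) μ →
  multFactorials (suc r) d (replicate c (suc r) ++ μ) ≡ multFactorials r (d ∸ c) μ * c !
multFactorials-prepend r d c μ μ≤r = begin
  (d ∸ length λs) ! * partFactorials (suc r) λs
    ≡⟨ cong₂ (λ a b → a ! * b) zeros (partFactorials-suc r λs) ⟩
  ((d ∸ c) ∸ length μ) ! * (partFactorials r λs * (mult (suc r) λs ! * 1))
    ≡⟨ cong₂ (λ a b → ((d ∸ c) ∸ length μ) ! * (a * (b ! * 1))) (partFactorials-prepend r c μ) tops ⟩
  ((d ∸ c) ∸ length μ) ! * (partFactorials r μ * (c ! * 1))
    ≡⟨ cong (λ z → ((d ∸ c) ∸ length μ) ! * (partFactorials r μ * z)) (NP.*-identityʳ (c !)) ⟩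
  ((d ∸ c) ∸ length μ) ! * (partFactorials r μ * c !)
    ≡⟨ sym (NP.*-assoc (((d ∸ c) ∸ length μ) !) (partFactorials r μ) (c !)) ⟩
  multFactorials r (d ∸ c) μ * c ! ∎
  where
  open ≡-Reasoning
  λs = replicate c (suc r) ++ μ
  zeros : d ∸ length λs ≡ (d ∸ c) ∸ length μ
  zeros = trans (cong (d ∸_) (trans (LP.length-++ (replicate c (suc r))) (cong (_+ length μ) (LP.length-replicate c))))
                (sym (NP.∸-+-assoc d c (length μ)))
  tops : mult (suc r) λs ≡ c
  tops = trans (mult-replicate-hit (suc r) c μ) (trans (cong (λ z → c + z) (mult-above r μ μ≤r)) (NP.+-identityʳ c))

Fits : ℕ → ℕ → List ℕ → Set
Fits r d μ = All (_≤ r) μ × (monomialAtOnes r d μ * multFactorials r d μ ≡ d !)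

monomialAtOnes-empty : ∀ d → monomialAtOnes 0 d [] ≡ 1
monomialAtOnes-empty d = monomialAtOnes-val 0 d [] 1 (trans (NP.+-identityʳ _) (NP.*-identityʳ (d !)))

fits-empty : ∀ d → Fits 0 d []
fits-empty d = [] , trans (cong (_* multFactorials 0 d []) (monomialAtOnes-empty d))
                          (trans (NP.+-identityʳ _) (NP.*-identityʳ (d !)))

module _ (r d c : ℕ) (c≤d : c ≤ d) (μ : List ℕ) (fits : Fits r (d ∸ c) μ) where

  private
    v : ℕ
    v = choose d c * monomialAtOnes r (d ∸ c) μ

    v-exact : v * multFactorials (suc r) d (replicate c (suc r) ++ μ) ≡ d !
    v-exact = begin
      v * multFactorials (suc r) d (replicate c (suc r) ++ μ)
        ≡⟨ cong (v *_) (multFactorials-prepend r d c μ (proj₁ fits)) ⟩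
      (choose d c * M) * (multFactorials r (d ∸ c) μ * c !)
        ≡⟨ NP.*-assoc (choose d c) _ _ ⟩
      choose d c * (M * (multFactorials r (d ∸ c) μ * c !))
        ≡⟨ cong (choose d c *_) (sym (NP.*-assoc M _ _)) ⟩
      choose d c * ((M * multFactorials r (d ∸ c) μ) * c !)
        ≡⟨ cong (λ z → choose d c * (z * c !)) (proj₂ fits) ⟩
      choose d c * ((d ∸ c) ! * c !)  ≡⟨ cong (choose d c *_) (NP.*-comm ((d ∸ c) !) (c !)) ⟩
      choose d c * (c ! * (d ∸ c) !)  ≡⟨ choose-factorials d c c≤d ⟩
      d !                             ∎
      where
      open ≡-Reasoning
      M = monomialAtOnes r (d ∸ c) μ

  monomial-prepend : monomialAtOnes (suc r) d (replicate c (suc r) ++ μ) ≡ choose d c * monomialAtOnes r (d ∸ c) μ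
  monomial-prepend = monomialAtOnes-val (suc r) d (replicate c (suc r) ++ μ) v v-exact

  fits-prepend : Fits (suc r) d (replicate c (suc r) ++ μ)
  fits-prepend = AllP.++⁺ (top c) (All.map NP.m≤n⇒m≤1+n (proj₁ fits)) ,
                 trans (cong (_* multFactorials (suc r) d (replicate c (suc r) ++ μ)) monomial-prepend) v-exact
    where
    top : ∀ c → All (_≤ suc r) (replicate c (suc r))
    top zero = []
    top (suc c) = NP.≤-refl ∷ top c

all-fit : ∀ r d → All (Fits r d) (boxParts r d)
all-fit zero zero = fits-empty 0 ∷ []
all-fit zero (suc d) = fits-empty (suc d) ∷ []
all-fit (suc r) d = All-boxParts r d (Fits (suc r) d) (λ c c≤d →
  All.map (λ {μ} → fits-prepend r d c c≤d μ) (all-fit r (d ∸ c)))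

boxSer : ℕ → ℕ → Ser
boxSer r d = listSer (boxParts r d) sum (λ μ → + monomialAtOnes r d μ)

-- By induction on r: the binomial theorem for D (r+1) = D r + x^(r+1)
-- matches the decomposition by the number c of parts equal to r+1.
boxSer-pow : ∀ r d → boxSer r d ≈ pow (D r) d
boxSer-pow zero d = SR.trans (mk≈ (empty-box d)) (SR.sym (pow-oneS d))
  where
  empty-box : ∀ d s → boxSer 0 d s ≡ oneS s
  empty-box zero s = trans (ZP.+-identityʳ _) (cond-cong (+ 1) (≡ᵇ-sym 0 s))
  empty-box (suc d) s = trans (ZP.+-identityʳ _)
    (trans (cong (λ z → cond (0 ≡ᵇ s) (+ z)) (monomialAtOnes-empty (suc d))) (cond-cong (+ 1) (≡ᵇ-sym 0 s)))
boxSer-pow (suc r) d = mk≈ λ s → begin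
  boxSer (suc r) d s
    ≡⟨ ΣL-boxParts r d _ ⟩
  Σ (suc d) (λ c → ΣL (boxParts r (d ∸ c)) (λ μ → cond (sum (replicate c (suc r) ++ μ) ≡ᵇ s)
                                                         (+ monomialAtOnes (suc r) d (replicate c (suc r) ++ μ))))
    ≡⟨ Σ-cong (suc d) (λ c c<sd → trans (ΣL-congAll (boxParts r (d ∸ c)) (All.map (prepended s c c<sd) (all-fit r (d ∸ c))))
         (listSer-shift (boxParts r (d ∸ c)) sum (λ μ → + monomialAtOnes r (d ∸ c) μ) (c * suc r) s (+ choose d c))) ⟩
  Σ (suc d) (λ c → + choose d c *ᶻ (X^ (c * suc r) ⋆ boxSer r (d ∸ c)) s)
    ≡⟨ Σ-cong′ (suc d) (λ c → cong (+ choose d c *ᶻ_) (at (⋆-cong (SR.sym (pow-X^ (suc r) c)) (boxSer-pow r (d ∸ c))) s)) ⟩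
  lincomb (suc d) (λ c → + choose d c) (λ c → pow (X^ (suc r)) c ⋆ pow (D r) (d ∸ c)) s
    ≡⟨ sym (at (binomial (D r) (X^ (suc r)) d) s) ⟩
  pow (D (suc r)) d s ∎
  where
  open ≡-Reasoning
  prepended : ∀ s c → c < suc d → ∀ {μ} → Fits r (d ∸ c) μ →
    cond (sum (replicate c (suc r) ++ μ) ≡ᵇ s) (+ monomialAtOnes (suc r) d (replicate c (suc r) ++ μ))
      ≡ cond (c * suc r + sum μ ≡ᵇ s) (+ choose d c *ᶻ + monomialAtOnes r (d ∸ c) μ)
  prepended s c c<sd {μ} fits =
    trans (cong₂ (λ a b → cond (a ≡ᵇ s) (+ b)) (sum-replicate c (suc r) μ) (monomial-prepend r d c (NP.≤-pred c<sd) μ fits))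
          (cong (cond (c * suc r + sum μ ≡ᵇ s)) (pos-*ᶻ (choose d c) _))

-- The generating function B of a single part that is ≢ 1 (mod k) and > k

-- negation, spelled as in Defs so that it agrees definitionally with admissible
not : Bool → Bool
not b = if b then false else true

module BSeries (k : ℕ) (2≤k : 2 ≤ k) where

  1≤k : 1 ≤ k
  1≤k = NP.≤-trans (s≤s z≤n) 2≤k

  open ASeries k 1≤k

  B : Ser
  B n = cond (not (cong1 k n) ∧ (k <ᵇ n)) (+ 1)

  B-0 : B 0 ≡ + 0
  B-0 = cong (λ b → cond b (+ 1)) (∧-zeroʳ (not (cong1 k 0)))

  offResidue : Ser
  offResidue n = cond (not ⌊ k ∣? suc n ⌋) (+ 1)

  suc-suc-k-2 : suc (suc (k ∸ 2)) ≡ k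
  suc-suc-k-2 = trans (cong suc (sym (NP.+-∸-assoc 1 2≤k))) (sym (NP.+-∸-assoc 1 1≤k))

  -- below k, n + 1 ≢ 0 (mod k) exactly for n ≤ k - 2, which is where D (k-2) is 1
  offResidue-below : ∀ n → n < k → offResidue n ≡ D (k ∸ 2) n
  offResidue-below n n<k with n NP.≤? (k ∸ 2)
  ... | yes n≤ = trans (cong (λ b → cond (not b) (+ 1)) (dec-iff (k ∣? suc n) (no (λ ()))
          (λ d → NP.<-irrefl refl (NP.≤-trans (NP.≤-trans (s≤s (s≤s n≤)) (NP.≤-reflexive suc-suc-k-2)) (∣⇒≤ d)))
          (λ ())))
        (sym (D-below (k ∸ 2) n n≤))
  ... | no n≰ = trans (cong (λ b → cond (not b) (+ 1)) (dec-iff (k ∣? suc n) (yes tt) (λ _ → tt) (λ _ → subst (k ∣_) k≡sn n∣n)))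
        (sym (D-above (k ∸ 2) n (NP.≰⇒> n≰)))
    where
    k≡sn : k ≡ suc n
    k≡sn = NP.≤-antisym (subst (_≤ suc n) suc-suc-k-2 (s≤s (NP.≰⇒> n≰))) n<k

  -- offResidue = D (k-2) + x^k offResidue, by periodicity mod k
  offResidue-rec : offResidue ≈ D (k ∸ 2) ⊕ X^ k ⋆ offResidue
  offResidue-rec = mk≈ coeff
    where
    coeff : ∀ n → offResidue n ≡ (D (k ∸ 2) ⊕ X^ k ⋆ offResidue) n
    coeff n with k NP.≤? n
    ... | no k≰n = trans (offResidue-below n (NP.≰⇒> k≰n))
          (trans (sym (ZP.+-identityʳ _)) (cong (D (k ∸ 2) n +ᶻ_) (sym (X^⋆-lt k offResidue n (NP.≰⇒> k≰n)))))
    ... | yes k≤n = begin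
      offResidue n
        ≡⟨ cong (λ b → cond (not b) (+ 1)) (dec-iff (k ∣? suc n) (k ∣? suc (n ∸ k))
             (λ d → ∣m+n∣m⇒∣n (subst (k ∣_) (sym shift) d) n∣n) (λ d → subst (k ∣_) shift (∣m∣n⇒∣m+n n∣n d))) ⟩
      offResidue (n ∸ k)
        ≡⟨ sym (ZP.+-identityˡ _) ⟩
      + 0 +ᶻ offResidue (n ∸ k)
        ≡⟨ cong₂ _+ᶻ_ (sym (D-above (k ∸ 2) n (NP.<-≤-trans (NP.∸-monoʳ-< (s≤s (z≤n {1})) 2≤k) k≤n)))
                      (sym (X^⋆-ge k offResidue n k≤n)) ⟩
      (D (k ∸ 2) ⊕ X^ k ⋆ offResidue) n ∎
      where
      open ≡-Reasoning
      shift : k + suc (n ∸ k) ≡ suc n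
      shift = trans (NP.+-suc k (n ∸ k)) (cong suc (NP.m+[n∸m]≡n k≤n))

  offResidue-quotient : offResidue ≈ D (k ∸ 2) ⋆ geom k
  offResidue-quotient = unique-solution (X^ k) (D (k ∸ 2)) offResidue (D (k ∸ 2) ⋆ geom k) (X^-0 1≤k) offResidue-rec
    (SR.trans (⋆-cong SR.refl (geom-rec k 1≤k))
      (solve 3 (λ d x e → d :* (con 1 :+ x :* e) := d :+ x :* (d :* e)) SR.refl (D (k ∸ 2)) (X^ k) (geom k)))

  B-shift : B ≈ X^ (suc (suc k)) ⋆ offResidue
  B-shift = mk≈ coeff
    where
    coeff : ∀ n → B n ≡ (X^ (suc (suc k)) ⋆ offResidue) n
    coeff n with suc (suc k) NP.≤? n
    ... | yes k+2≤n = trans (cong₂ (λ b c → cond (not b ∧ c) (+ 1))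
            (dec-iff (k ∣? (n ∸ 1)) (k ∣? suc n′) (λ d → ∣m+n∣m⇒∣n (subst (k ∣_) n-1 d) n∣n)
                     (λ d → subst (k ∣_) (sym n-1) (∣m∣n⇒∣m+n n∣n d)))
            (<ᵇ-true (NP.<-trans (NP.n<1+n k) k+2≤n)))
          (trans (cong (λ b → cond b (+ 1)) (∧-identityʳ _)) (sym (X^⋆-ge (suc (suc k)) offResidue n k+2≤n)))
      where
      n′ = n ∸ suc (suc k)
      n-1 : n ∸ 1 ≡ k + suc n′
      n-1 = trans (cong (_∸ 1) (sym (NP.m+[n∸m]≡n k+2≤n))) (sym (NP.+-suc k n′))
    ... | no k+2≰n = trans small (sym (X^⋆-lt (suc (suc k)) offResidue n (NP.≰⇒> k+2≰n)))
      where
      -- the only part in (k, k+2) is k+1 ≡ 1 (mod k)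
      small : B n ≡ + 0
      small with k NP.<? n
      ... | no k≮n = trans (cong (λ c → cond (not (cong1 k n) ∧ c) (+ 1)) (<ᵇ-false k≮n))
                           (cong (λ b → cond b (+ 1)) (∧-zeroʳ _))
      ... | yes k<n = cong (λ b → cond (not b ∧ (k <ᵇ n)) (+ 1))
            (dec-iff (k ∣? (n ∸ 1)) (yes tt) (λ _ → tt) (λ _ → subst (k ∣_) (sym n-1≡k) n∣n))
        where
        n-1≡k : n ∸ 1 ≡ k
        n-1≡k = cong (_∸ 1) (NP.≤-antisym (NP.≤-pred (NP.≰⇒> k+2≰n)) k<n)

  B-closed : B ≈ X^ (suc k) ⋆ (D (k ∸ 2) ⋆ A)
  B-closed = SR.trans B-shift (SR.trans
    (⋆-cong (SR.sym (SR.trans (X^-+ (suc k) 1) (X^-cong (NP.+-comm (suc k) 1)))) offResidue-quotient)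
    (solve 4 (λ x y d e → (x :* y) :* (d :* e) := x :* (d :* (y :* e))) SR.refl (X^ (suc k)) (X^ 1) (D (k ∸ 2)) (geom k)))

-- Counting compositions by their first part

compsFuel-enough : ∀ f g u → u ≤ f → u ≤ g → compsFuel f u ≡ compsFuel g u
compsFuel-enough f g zero _ _ = refl
compsFuel-enough (suc f) (suc g) (suc u) (s≤s u≤f) (s≤s u≤g) = cong concat (begin
  map G (map suc (upTo (suc u)))          ≡⟨ sym (LP.map-∘ (upTo (suc u))) ⟩
  map (λ t → G (suc t)) (upTo (suc u))    ≡⟨ LP.map-upTo _ (suc u) ⟩
  applyUpTo (λ t → G (suc t)) (suc u)
    ≡⟨ applyUpTo-cong (suc u) _ _ (λ t t<su → cong (map (suc t ∷_))
         (compsFuel-enough f g (u ∸ t) (NP.≤-trans (NP.m∸n≤m u t) u≤f) (NP.≤-trans (NP.m∸n≤m u t) u≤g))) ⟩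
  applyUpTo (λ t → H (suc t)) (suc u)     ≡⟨ sym (LP.map-upTo _ (suc u)) ⟩
  map (λ t → H (suc t)) (upTo (suc u))    ≡⟨ LP.map-∘ (upTo (suc u)) ⟩
  map H (map suc (upTo (suc u)))          ∎)
  where
  open ≡-Reasoning
  G H : ℕ → List (List ℕ)
  G p = map (p ∷_) (compsFuel f (suc u ∸ p))
  H p = map (p ∷_) (compsFuel g (suc u ∸ p))

countB-∷ : {A : Set} (P : A → Bool) (x : A) (xs : List A) →
  countB P (x ∷ xs) ≡ (if P x then suc (countB P xs) else countB P xs)
countB-∷ P x xs with P x
... | true = refl
... | false = refl

-- The admissibility test of a composition p ∷ c, split according to p:
-- either p ≡ 1 (mod k), or p is one of the counted parts (then c must
-- have one counted part fewer), where  ok  says all parts of c are allowed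
-- and  x  is the number of counted parts of c.
admissible-split : ∀ isOne isBig ok x m →
  cond (((isOne ∨ isBig) ∧ ok) ∧ ((if not isOne then suc x else x) ≡ᵇ m)) (+ 1)
    ≡ cond isOne (+ 1) *ᶻ cond (ok ∧ (x ≡ᵇ m)) (+ 1) +ᶻ cond (not isOne ∧ isBig) (+ 1) *ᶻ cond (ok ∧ (suc x ≡ᵇ m)) (+ 1)
admissible-split true isBig ok x m = sym (trans (cong₂ _+ᶻ_ (*ᶻ-identityˡ _) (*ᶻ-zeroˡ _)) (ZP.+-identityʳ _))
admissible-split false false ok x m = sym (cong₂ _+ᶻ_ (*ᶻ-zeroˡ _) (*ᶻ-zeroˡ _))
admissible-split false true ok x m = sym (trans (cong₂ _+ᶻ_ (*ᶻ-zeroˡ _) (*ᶻ-identityˡ _)) (ZP.+-identityˡ _))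

module Compositions (k : ℕ) (2≤k : 2 ≤ k) where

  open BSeries k 2≤k
  open ASeries k 1≤k

  aSer : ℕ → Ser
  aSer m n = + a k n m

  fewerSer : ℕ → Ser
  fewerSer zero = zeroS
  fewerSer (suc m) = aSer m

  emptySer : ℕ → Ser
  emptySer zero = oneS
  emptySer (suc m) = zeroS

  allowed counted : ℕ → Bool
  allowed p = cong1 k p ∨ (k <ᵇ p)
  counted p = not (cong1 k p)

  indicator : ℕ → List ℕ → ℤ
  indicator m c = cond (admissible k m c) (+ 1)

  fewerIndicator : ℕ → List ℕ → ℤ
  fewerIndicator m c = cond (all allowed c ∧ (suc (countB counted c) ≡ᵇ m)) (+ 1)

  aSer-ΣL : ∀ m u f → u ≤ f → aSer m u ≡ ΣL (compsFuel f u) (indicator m)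
  aSer-ΣL m u f u≤f = trans (cast-countB (admissible k m) (compositions u))
    (cong (λ z → ΣL z (indicator m)) (compsFuel-enough u f u NP.≤-refl u≤f))

  fewerSer-ΣL : ∀ m f u → u ≤ f → ΣL (compsFuel f u) (fewerIndicator m) ≡ fewerSer m u
  fewerSer-ΣL zero f u _ = ΣL-0 (compsFuel f u) _ (λ c → cond-cong (+ 1) (∧-zeroʳ _))
  fewerSer-ΣL (suc m) f u u≤f = sym (aSer-ΣL m u f u≤f)

  indicator-cons : ∀ m p c →
    indicator m (p ∷ c) ≡ cond (cong1 k p) (+ 1) *ᶻ indicator m c +ᶻ B p *ᶻ fewerIndicator m c
  indicator-cons m p c =
    trans (cong (λ z → cond ((allowed p ∧ all allowed c) ∧ (z ≡ᵇ m)) (+ 1)) (countB-∷ counted p c))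
          (admissible-split (cong1 k p) (k <ᵇ p) (all allowed c) (countB counted c) m)

  first-part : ∀ m t f u → u ≤ f →
    ΣL (map (suc t ∷_) (compsFuel f u)) (indicator m) ≡ A (suc t) *ᶻ aSer m u +ᶻ B (suc t) *ᶻ fewerSer m u
  first-part m t f u u≤f = begin
    ΣL (map (suc t ∷_) cs) (indicator m)
      ≡⟨ ΣL-map cs (suc t ∷_) (indicator m) ⟩
    ΣL cs (λ c → indicator m (suc t ∷ c))
      ≡⟨ ΣL-cong cs (indicator-cons m (suc t)) ⟩
    ΣL cs (λ c → geom k t *ᶻ indicator m c +ᶻ B (suc t) *ᶻ fewerIndicator m c)
      ≡⟨ ΣL-+ cs _ _ ⟩
    ΣL cs (λ c → geom k t *ᶻ indicator m c) +ᶻ ΣL cs (λ c → B (suc t) *ᶻ fewerIndicator m c)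
      ≡⟨ cong₂ _+ᶻ_ (sym (ΣL-*ˡ cs (geom k t) (indicator m))) (sym (ΣL-*ˡ cs (B (suc t)) (fewerIndicator m))) ⟩
    geom k t *ᶻ ΣL cs (indicator m) +ᶻ B (suc t) *ᶻ ΣL cs (fewerIndicator m)
      ≡⟨ cong₂ _+ᶻ_ (cong₂ _*ᶻ_ (sym (X^⋆-ge 1 (geom k) (suc t) (s≤s z≤n))) (sym (aSer-ΣL m u f u≤f)))
                    (cong (B (suc t) *ᶻ_) (fewerSer-ΣL m f u u≤f)) ⟩
    A (suc t) *ᶻ aSer m u +ᶻ B (suc t) *ᶻ fewerSer m u ∎
    where
    open ≡-Reasoning
    cs = compsFuel f u

  source : ℕ → Ser
  source m = emptySer m ⊕ B ⋆ fewerSer m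

  private
    emptySer-suc : ∀ m n → emptySer m (suc n) ≡ + 0
    emptySer-suc zero n = refl
    emptySer-suc (suc m) n = refl

    empty-composition : ∀ m → aSer m 0 ≡ (source m ⊕ A ⋆ aSer m) 0
    empty-composition m = begin
      aSer m 0                            ≡⟨ cast-countB (admissible k m) [ [] ] ⟩
      cond (0 ≡ᵇ m) (+ 1) +ᶻ + 0          ≡⟨ cong₂ _+ᶻ_ (single m) (sym (⋆-head-free A (aSer m) 0 A-0)) ⟩
      emptySer m 0 +ᶻ (A ⋆ aSer m) 0      ≡⟨ cong (_+ᶻ (A ⋆ aSer m) 0) (sym (trans (cong (emptySer m 0 +ᶻ_)
                                                (⋆-head-free B (fewerSer m) 0 B-0)) (ZP.+-identityʳ (emptySer m 0)))) ⟩
      (source m ⊕ A ⋆ aSer m) 0           ∎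
      where
      open ≡-Reasoning
      single : ∀ m → cond (0 ≡ᵇ m) (+ 1) ≡ emptySer m 0
      single zero = refl
      single (suc m) = refl

    -- classify the compositions of n + 1 by their first part t + 1
    by-first-part : ∀ m n → aSer m (suc n) ≡ (source m ⊕ A ⋆ aSer m) (suc n)
    by-first-part m n = begin
      aSer m (suc n)
        ≡⟨ aSer-ΣL m (suc n) (suc n) NP.≤-refl ⟩
      ΣL (concatMap starting (map suc (upTo (suc n)))) (indicator m)
        ≡⟨ trans (ΣL-concatMap starting (map suc (upTo (suc n))) (indicator m)) (ΣL-map (upTo (suc n)) suc (λ p → ΣL (starting p) (indicator m))) ⟩
      ΣL (upTo (suc n)) (λ t → ΣL (starting (suc t)) (indicator m))
        ≡⟨ ΣL-upTo (suc n) (λ t → ΣL (starting (suc t)) (indicator m)) ⟩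
      Σ (suc n) (λ t → ΣL (starting (suc t)) (indicator m))
        ≡⟨ Σ-cong′ (suc n) (λ t → first-part m t n (n ∸ t) (NP.m∸n≤m n t)) ⟩
      Σ (suc n) (λ t → A (suc t) *ᶻ aSer m (n ∸ t) +ᶻ B (suc t) *ᶻ fewerSer m (n ∸ t))
        ≡⟨ Σ-+ (suc n) _ _ ⟩
      Σ (suc n) (λ t → A (suc t) *ᶻ aSer m (n ∸ t)) +ᶻ Σ (suc n) (λ t → B (suc t) *ᶻ fewerSer m (n ∸ t))
        ≡⟨ cong₂ _+ᶻ_ (sym (⋆-head-free A (aSer m) (suc n) A-0)) (sym (⋆-head-free B (fewerSer m) (suc n) B-0)) ⟩
      (A ⋆ aSer m) (suc n) +ᶻ (B ⋆ fewerSer m) (suc n)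
        ≡⟨ ZP.+-comm ((A ⋆ aSer m) (suc n)) ((B ⋆ fewerSer m) (suc n)) ⟩
      (B ⋆ fewerSer m) (suc n) +ᶻ (A ⋆ aSer m) (suc n)
        ≡⟨ cong (_+ᶻ (A ⋆ aSer m) (suc n)) (sym (trans (cong (_+ᶻ (B ⋆ fewerSer m) (suc n)) (emptySer-suc m n))
                                                       (ZP.+-identityˡ ((B ⋆ fewerSer m) (suc n))))) ⟩
      (source m ⊕ A ⋆ aSer m) (suc n) ∎
      where
      open ≡-Reasoning
      starting : ℕ → List (List ℕ)
      starting p = map (p ∷_) (compsFuel n (suc n ∸ p))

  aSer-rec : ∀ m → aSer m ≈ source m ⊕ A ⋆ aSer m
  aSer-rec m = mk≈ λ { zero → empty-composition m ; (suc n) → by-first-part m n }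

-- Both sums are coefficients of  Z_m = x^{(k+1)m} P_m D(k-2)^m

regroup : ∀ s b c b′ c′ → s ℤ.* + (b * c * b′ * c′) ≡ (+ b *ᶻ + c) *ᶻ ((s *ᶻ + b′) *ᶻ + c′)
regroup s b c b′ c′ = begin
  s ℤ.* + (b * c * b′ * c′)
    ≡⟨ cong (s ℤ.*_) (trans (ZP.pos-* (b * c * b′) c′) (cong (ℤ._* + c′) (trans (ZP.pos-* (b * c) b′)
         (cong (ℤ._* + b′) (ZP.pos-* b c))))) ⟩
  s ℤ.* (+ b ℤ.* + c ℤ.* + b′ ℤ.* + c′)
    ≡⟨ reassociate s (+ b) (+ c) (+ b′) (+ c′) ⟩
  (+ b ℤ.* + c) ℤ.* ((s ℤ.* + b′) ℤ.* + c′)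
    ≡⟨ sym (trans (*ᶻ-def _ _) (cong₂ ℤ._*_ (*ᶻ-def (+ b) (+ c)) (trans (*ᶻ-def _ _) (cong (ℤ._* + c′) (*ᶻ-def s (+ b′)))))) ⟩
  (+ b *ᶻ + c) *ᶻ ((s *ᶻ + b′) *ᶻ + c′) ∎
  where
  open ≡-Reasoning
  reassociate : ∀ s b c b′ c′ → s ℤ.* (b ℤ.* c ℤ.* b′ ℤ.* c′) ≡ (b ℤ.* c) ℤ.* ((s ℤ.* b′) ℤ.* c′)
  reassociate = solve-∀

module BothSums (k : ℕ) (2≤k : 2 ≤ k) where

  open BSeries k 2≤k
  open ASeries k 1≤k
  open Compositions k 2≤k using (aSer; source; aSer-rec)

  Z : ℕ → Ser
  Z m = X^ (suc k * m) ⋆ (P m ⋆ pow (D (k ∸ 2)) m)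

  sum1-coeff : ∀ n m → + sum1 k n m ≡ (X^ (suc k * m) ⋆ (P m ⋆ boxSer (k ∸ 2) m)) n
  sum1-coeff n m = begin
    + sum1 k n m
      ≡⟨ cast-sumUpTo (suc n) _ ⟩
    Σ (suc n) (λ i → + sumℕ n (λ j → Term i j))
      ≡⟨ Σ-cong′ (suc n) (λ i → trans (cast-sumUpTo (suc n) _) (Σ-cong′ (suc n) (term-coeff i))) ⟩
    Σ (suc n) (λ i → Σ (suc n) (λ j → (+ choose i m *ᶻ + multichoose i j) *ᶻ (X^ (i + suc k * m + j * k) ⋆ boxSer (k ∸ 2) m) n))
      ≡⟨ ij-sum m (suc k * m) (boxSer (k ∸ 2) m) n ⟩
    (X^ (suc k * m) ⋆ (P m ⋆ boxSer (k ∸ 2) m)) n ∎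
    where
    open ≡-Reasoning
    boxes = boxParts (k ∸ 2) m
    Term : ℕ → ℕ → ℕ
    Term i j = sumListℕ boxes λ λs →
      if (i + suc k * m + j * k + sum λs) ≡ᵇ n
      then choose i m * multichoose i j * monomialAtOnes (k ∸ 2) m λs
      else 0
    term-coeff : ∀ i j → + Term i j ≡ (+ choose i m *ᶻ + multichoose i j) *ᶻ (X^ (i + suc k * m + j * k) ⋆ boxSer (k ∸ 2) m) n
    term-coeff i j = trans (cast-sumL boxes _)
      (trans (ΣL-cong boxes (λ λs → trans (cast-if _ _) (cong (cond _) (factor λs))))
        (listSer-shift boxes sum (λ λs → + monomialAtOnes (k ∸ 2) m λs) (i + suc k * m + j * k) n (+ choose i m *ᶻ + multichoose i j)))
      where
      factor : ∀ λs → + (choose i m * multichoose i j * monomialAtOnes (k ∸ 2) m λs)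
                      ≡ (+ choose i m *ᶻ + multichoose i j) *ᶻ + monomialAtOnes (k ∸ 2) m λs
      factor λs = trans (pos-*ᶻ (choose i m * multichoose i j) _) (cong (_*ᶻ + monomialAtOnes (k ∸ 2) m λs) (pos-*ᶻ (choose i m) (multichoose i j)))

  1≤k-1 : 1 ≤ k ∸ 1
  1≤k-1 = NP.∸-monoˡ-≤ 1 2≤k

  V U : ℕ → Ser
  V m = signedSer (k ∸ 1) m
  U m = multichooseSer m

  lh-sum : ∀ n m e (w : ℤ) →
    Σ (suc n) (λ l → Σ (suc n) (λ h → cond (e + l * (k ∸ 1) + h ≡ᵇ n)
        (w *ᶻ ((sgn l *ᶻ + choose m l) *ᶻ + multichoose m h))))
      ≡ w *ᶻ (X^ e ⋆ (V m ⋆ U m)) n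
  lh-sum n m e w = begin
    Σ (suc n) (λ l → Σ (suc n) (λ h → cond (e + l * (k ∸ 1) + h ≡ᵇ n) (w *ᶻ (S l *ᶻ U m h))))
      ≡⟨ Σ-cong′ (suc n) (λ l → trans (Σ-cong′ (suc n) (λ h → trans (cond-* _ w _) (cong (w *ᶻ_) (cond-* _ (S l) _))))
           (trans (sym (Σ-*ˡ (suc n) w _)) (cong (w *ᶻ_) (trans (sym (Σ-*ˡ (suc n) (S l) _))
             (cong (S l *ᶻ_) (X^⋆-coeff (U m) (e + l * (k ∸ 1)) n)))))) ⟩
    Σ (suc n) (λ l → w *ᶻ (S l *ᶻ (X^ (e + l * (k ∸ 1)) ⋆ U m) n))
      ≡⟨ sym (Σ-*ˡ (suc n) w _) ⟩
    w *ᶻ Σ (suc n) (λ l → S l *ᶻ (X^ (e + l * (k ∸ 1)) ⋆ U m) n)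
      ≡⟨ cong (w *ᶻ_) (Σ-cong′ (suc n) (λ l → cong (S l *ᶻ_) (at (split-exponent l) n))) ⟩
    w *ᶻ Σ (suc n) (λ l → S l *ᶻ (X^ (l * (k ∸ 1)) ⋆ (X^ e ⋆ U m)) n)
      ≡⟨ cong (w *ᶻ_) (sym (supportSer-⋆ (λ l → l * (k ∸ 1)) (j≤j*k 1≤k-1) S (X^ e ⋆ U m) n)) ⟩
    w *ᶻ (V m ⋆ (X^ e ⋆ U m)) n
      ≡⟨ cong (w *ᶻ_) (at (solve 3 (λ v x u → v :* (x :* u) := x :* (v :* u)) SR.refl (V m) (X^ e) (U m)) n) ⟩
    w *ᶻ (X^ e ⋆ (V m ⋆ U m)) n ∎
    where
    open ≡-Reasoning
    S : ℕ → ℤ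
    S l = sgn l *ᶻ + choose m l
    split-exponent : ∀ l → X^ (e + l * (k ∸ 1)) ⋆ U m ≈ X^ (l * (k ∸ 1)) ⋆ (X^ e ⋆ U m)
    split-exponent l = SR.trans (⋆-cong (SR.trans (X^-cong (NP.+-comm e (l * (k ∸ 1)))) (SR.sym (X^-+ (l * (k ∸ 1)) e))) SR.refl)
                                (⋆-assoc (X^ (l * (k ∸ 1))) (X^ e) (U m))

  sum2-coeff : ∀ n m → sum2 k n m ≡ (X^ (suc k * m) ⋆ (P m ⋆ (V m ⋆ U m))) n
  sum2-coeff n m = begin
    sum2 k n m
      ≡⟨ foldr-sumUpTo (suc n) _ ⟩
    Σ (suc n) (λ i → sumℤ n (λ j → sumℤ n (λ l → sumℤ n (λ h → Term i j l h))))
      ≡⟨ Σ-cong′ (suc n) (λ i → trans (foldr-sumUpTo (suc n) _) (Σ-cong′ (suc n) (λ j →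
           trans (foldr-sumUpTo (suc n) _) (trans (Σ-cong′ (suc n) (λ l → foldr-sumUpTo (suc n) _)) (inner i j))))) ⟩
    Σ (suc n) (λ i → Σ (suc n) (λ j → (+ choose i m *ᶻ + multichoose i j) *ᶻ (X^ (i + suc k * m + j * k) ⋆ (V m ⋆ U m)) n))
      ≡⟨ ij-sum m (suc k * m) (V m ⋆ U m) n ⟩
    (X^ (suc k * m) ⋆ (P m ⋆ (V m ⋆ U m))) n ∎
    where
    open ≡-Reasoning
    Term : ℕ → ℕ → ℕ → ℕ → ℤ
    Term i j l h = if (i + suc k * m + j * k + l * (k ∸ 1) + h) ≡ᵇ n
      then sgn l ℤ.* + (choose i m * multichoose i j * choose m l * multichoose m h)
      else + 0
    inner : ∀ i j → Σ (suc n) (λ l → Σ (suc n) (λ h → Term i j l h))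
                      ≡ (+ choose i m *ᶻ + multichoose i j) *ᶻ (X^ (i + suc k * m + j * k) ⋆ (V m ⋆ U m)) n
    inner i j = trans (Σ-cong′ (suc n) (λ l → Σ-cong′ (suc n) (λ h →
                  cong (cond _) (regroup (sgn l) (choose i m) (multichoose i j) (choose m l) (multichoose m h)))))
                (lh-sum n m (i + suc k * m + j * k) (+ choose i m *ᶻ + multichoose i j))

  Z-rec-0 : Z 0 ≈ source 0 ⊕ A ⋆ Z 0
  Z-rec-0 = begin
    Z 0                           ≈⟨ Z0≈P0 ⟩
    P 0                           ≈⟨ P-rec-0 ⟩
    oneS ⊕ A ⋆ P 0                ≈⟨ SR.+-cong (SR.sym (SR.trans (SR.+-cong (SR.refl {oneS}) (⋆-zeroʳ B)) (SR.+-identityʳ oneS)))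
                                               (⋆-cong (SR.refl {A}) (SR.sym Z0≈P0)) ⟩
    (oneS ⊕ B ⋆ zeroS) ⊕ A ⋆ Z 0  ∎
    where
    open ≈-Reasoning
    Z0≈P0 : Z 0 ≈ P 0
    Z0≈P0 = SR.trans (⋆-cong (X^-cong (NP.*-zeroʳ (suc k))) SR.refl) (SR.trans (oneS-⋆ _) (⋆-oneS (P 0)))

  -- Z_{m+1} = B Z_m + A Z_{m+1}, from P_{m+1} = A (P_{m+1} + P_m) and B = x^{k+1} D(k-2) A
  Z-rec-suc : ∀ m → Z (suc m) ≈ (zeroS ⊕ B ⋆ Z m) ⊕ A ⋆ Z (suc m)
  Z-rec-suc m = begin
    Z (suc m)
      ≈⟨ ⋆-cong x^-split (⋆-cong (P-rec-suc m) SR.refl) ⟩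
    (X^ (suc k) ⋆ X^ (suc k * m)) ⋆ ((A ⋆ (P (suc m) ⊕ P m)) ⋆ (D (k ∸ 2) ⋆ pow (D (k ∸ 2)) m))
      ≈⟨ solve 7 (λ y y′ a p p′ d dm →
           (y :* y′) :* ((a :* (p :+ p′)) :* (d :* dm)) :=
           (con 0 :+ (y :* (d :* a)) :* (y′ :* (p′ :* dm))) :+ a :* ((y :* y′) :* (p :* (d :* dm)))) SR.refl
           (X^ (suc k)) (X^ (suc k * m)) A (P (suc m)) (P m) (D (k ∸ 2)) (pow (D (k ∸ 2)) m) ⟩
    (zeroS ⊕ (X^ (suc k) ⋆ (D (k ∸ 2) ⋆ A)) ⋆ Z m) ⊕ A ⋆ ((X^ (suc k) ⋆ X^ (suc k * m)) ⋆ (P (suc m) ⋆ pow (D (k ∸ 2)) (suc m)))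
      ≈⟨ SR.+-cong (SR.+-cong (SR.refl {zeroS}) (⋆-cong (SR.sym B-closed) (SR.refl {Z m})))
                   (⋆-cong (SR.refl {A}) (⋆-cong (SR.sym x^-split) (SR.refl {P (suc m) ⋆ pow (D (k ∸ 2)) (suc m)}))) ⟩
    (zeroS ⊕ B ⋆ Z m) ⊕ A ⋆ Z (suc m) ∎
    where
    open ≈-Reasoning
    x^-split : X^ (suc k * suc m) ≈ X^ (suc k) ⋆ X^ (suc k * m)
    x^-split = SR.trans (X^-cong (NP.*-suc (suc k) m)) (SR.sym (X^-+ (suc k) (suc k * m)))

  -- both satisfy the same recursion, so  Σ_n a^{(m)}_{k,n} x^n = Z_m
  aSer≈Z : ∀ m → aSer m ≈ Z m
  aSer≈Z zero = unique-solution A (source 0) (aSer 0) (Z 0) A-0 (aSer-rec 0) Z-rec-0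
  aSer≈Z (suc m) = unique-solution A (source (suc m)) (aSer (suc m)) (Z (suc m)) A-0 (aSer-rec (suc m))
    (SR.trans (Z-rec-suc m) (SR.+-cong (SR.+-cong (SR.refl {zeroS}) (⋆-cong (SR.refl {B}) (SR.sym (aSer≈Z m))))
                                        (SR.refl {A ⋆ Z (suc m)})))

  -- the first formula: D(k-2)^m is the box series
  sum1≡Z : ∀ n m → + sum1 k n m ≡ Z m n
  sum1≡Z n m = trans (sum1-coeff n m) (at (⋆-cong SR.refl (⋆-cong SR.refl (boxSer-pow (k ∸ 2) m))) n)

  -- the second formula: D(k-2)^m = (1 - x^{k-1})^m / (1 - x)^m
  sum2≡Z : ∀ n m → sum2 k n m ≡ Z m n
  sum2≡Z n m = trans (sum2-coeff n m) (at (⋆-cong SR.refl (⋆-cong SR.refl VU≈Dᵐ)) n)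
    where
    k-1≡ : k ∸ 1 ≡ suc (k ∸ 2)
    k-1≡ = NP.+-∸-assoc 1 2≤k
    VU≈Dᵐ : V m ⋆ U m ≈ pow (D (k ∸ 2)) m
    VU≈Dᵐ = SR.trans (⋆-cong (mk≈ λ v → cong (λ s → signedSer s m v) k-1≡) SR.refl) (signed-multichoose-pow (k ∸ 2) m)

-- Both sides of each identity are the coefficient of x^n in Z_m.
theorem1p7 : (k n m : ℕ) → 2 ≤ k →
    (a k n m ≡ sum1 k n m) × (+ sum1 k n m ≡ sum2 k n m)
theorem1p7 k n m 2≤k =
  ZP.+-injective (trans (at (aSer≈Z m) n) (sym (sum1≡Z n m))) , trans (sum1≡Z n m) (sym (sum2≡Z n m))
  where open BothSums k 2≤k
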